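{- Let $\lambda,\mu,\nu$ be polynomial dominant weights of $GL_n$ with $\mu_i\le\lambda_i$ for all $i$. For $L\in LR(\lambda/\mu,\nu)$ define the $t$-array $U(L)=(u^{(k)}_j)_{1\le j\le k\le n}$ by $$u^{(k)}_j=\mu_{n-k+j}+\#\{\text{entries}\le n-k\text{ in row } n-k+j \text{ of } L\},$$ and let $\phi(L)=U(L)^*$ be its dual array. Then $\phi$ is a bijection from $LR(\lambda/\mu,\nu)$ onto $GZ(\mu^*,\lambda^*-\nu^*,\nu^*)$.
   Context: A polynomial dominant weight of $GL_n$ is a sequence of nonnegative integers $\lambda=(\lambda_1,\dots,\lambda_n)$ with $\lambda_1\ge\dots\ge\lambda_n$; its dual is $\lambda^*=(-\lambda_n,\dots,-\lambda_1)$; differences are componentwise. Tableaux are drawn in English convention; row $r$ of the skew shape $\lambda/\mu$ consists of the boxes in columns $\mu_r+1,\dots,\lambda_r$. A tableau on $\lambda/\mu$ (filling of its boxes with positive integers) is an LR tableau if (1) it is semistandard: entries weakly increase left to right along rows and strictly increase top to bottom down columns; and (2) its reverse reading word is Yamanouchi: if $x_1x_2\cdots x_r$ is the word obtained by reading entries left to right in each row, starting from the bottom row and going up, then for every $s$ the word $x_rx_{r-1}\cdots x_s$ contains at least as many $a$'s as $(a+1)$'s for every $a\ge1$. Its content is $\nu$ if the entry $k$ appears exactly $\nu_k$ times for each $k$ (so entries lie in $\{1,\dots,n\}$). $LR(\lambda/\mu,\nu)$ denotes the set of LR tableaux of shape $\lambda/\mu$ and content $\nu$. A $t$-array is an integer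 array $T=(t^{(i)}_j)_{1\le j\le i\le n}$; its type is its $n$-th row $(t^{(n)}_1,\dots,t^{(n)}_n)$; its weight is $(w_1,\dots,w_n)$ with $w_1=t^{(1)}_1$, $w_i=\sum_{k=1}^i t^{(i)}_k-\sum_{k=1}^{i-1}t^{(i-1)}_k$ for $i\ge2$; its dual array is $T^*=(s^{(i)}_j)$ with $s^{(i)}_j=-t^{(i)}_{i+1-j}$. $T$ is a GT pattern if $t^{(i+1)}_j\ge t^{(i)}_j$ and $t^{(i)}_j\ge t^{(i+1)}_{j+1}$ for all $1\le j\le i\le n-1$. Its exponents are $\varepsilon^{(i)}_j(T)=\sum_{1\le h<j}(t^{(i+1)}_h-2t^{(i)}_h+t^{(i-1)}_h)+(t^{(i+1)}_j-t^{(i)}_j)$ for $1\le j\le i\le n-1$. For weakly decreasing $\alpha,\gamma\in\mathbb{Z}^n$ and $\beta\in\mathbb{Z}^n$, $GZ(\alpha,\beta,\gamma)$ is the set of GT patterns of type $\alpha$ and weight $\beta$ with $\varepsilon^{(i)}_j(T)\le\gamma_i-\gamma_{i+1}$ for all $1\le j\le i\le n-1$. -}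

module Defs where

open import Data.Nat as ℕ using (ℕ; zero; suc; _∸_; _≤_; _<_; _≤?_)
open import Data.Nat.Properties using () renaming (_≟_ to _≟ℕ_)
open import Data.Integer as ℤ using (ℤ; +_; -_)
open import Data.Fin using (Fin; toℕ)
open import Data.Vec as Vec using (Vec; lookup)
open import Data.List as List using (List; []; _∷_; length; filter; drop; concat)
open import Data.List.Relation.Unary.All using (All)
open import Data.Maybe using (Maybe; just; nothing)
open import Data.Product using (_×_; Σ)
open import Relation.Binary.PropositionalEquality using (_≡_)
open import Relation.Nullary using (yes; no)

-- 1-based access to a vector of naturals (value 0 outside 1..n; only
-- ever used inside the range).
at : ∀ {n} → Vec ℕ n → ℕ → ℕ
at Vec.[]       _             = 0
at (x Vec.∷ xs) zero          = 0
at (x Vec.∷ xs) (suc zero)    = x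
at (x Vec.∷ xs) (suc (suc i)) = at xs (suc i)

atℤ : ∀ {n} → Vec ℤ n → ℕ → ℤ
atℤ Vec.[]       _             = + 0
atℤ (x Vec.∷ xs) zero          = + 0
atℤ (x Vec.∷ xs) (suc zero)    = x
atℤ (x Vec.∷ xs) (suc (suc i)) = atℤ xs (suc i)

Dominant : ∀ {n} → Vec ℕ n → Set
Dominant {n} w = ∀ i → 1 ≤ i → i < n → at w (suc i) ≤ at w i

dual : ∀ {n} → Vec ℕ n → Vec ℤ n
dual w = Vec.map (λ x → - (+ x)) (Vec.reverse w)

_-ᵥ_ : ∀ {n} → Vec ℤ n → Vec ℤ n → Vec ℤ n
_-ᵥ_ = Vec.zipWith ℤ._-_

-- Tableaux on λ/μ: row r (0-based Fin index) is the list of entries of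
-- the boxes in columns μ_r+1, …, λ_r, read left to right.

Tableau : ℕ → Set
Tableau n = Vec (List ℕ) n

nth : ∀ {A : Set} → List A → ℕ → Maybe A
nth []       _       = nothing
nth (x ∷ xs) zero    = just x
nth (x ∷ xs) (suc i) = nth xs i

-- entry of row r in (1-based) column c, if that box belongs to λ/μ
entry : ∀ {n} → (μ : Vec ℕ n) → Tableau n → Fin n → ℕ → Maybe ℕ
entry μ L r c with c ≤? lookup μ r
... | yes _ = nothing
... | no  _ = nth (lookup L r) (c ∸ suc (lookup μ r))

count : ℕ → List ℕ → ℕ
count k w = length (filter (_≟ℕ k) w)

readingWord : ∀ {n} → Tableau n → List ℕ
readingWord L = concat (List.reverse (Vec.toList L))

record IsLR {n} (lam μ ν : Vec ℕ n) (L : Tableau n) : Set where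
  field
    shape      : ∀ r → length (lookup L r) ≡ lookup lam r ∸ lookup μ r
    rowWeak    : ∀ r c c' x y → c < c' → entry μ L r c ≡ just x →
                 entry μ L r c' ≡ just y → x ≤ y
    colStrict  : ∀ r r' → toℕ r < toℕ r' → ∀ c x y → entry μ L r c ≡ just x →
                 entry μ L r' c ≡ just y → x < y
    yamanouchi : ∀ s a → 1 ≤ a →
                 count (suc a) (drop s (readingWord L)) ≤ count a (drop s (readingWord L))
    entryRange : All (λ x → 1 ≤ x × x ≤ n) (readingWord L)
    content    : ∀ (k : Fin n) → count (suc (toℕ k)) (readingWord L) ≡ lookup ν k

-- t-arrays: T i j = t^{(i)}_j, meaningful for 1 ≤ j ≤ i ≤ n (1-based).

TArray : Set
TArray = ℕ → ℕ → ℤ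

_≈[_]_ : TArray → ℕ → TArray → Set
T ≈[ n ] S = ∀ i j → 1 ≤ j → j ≤ i → i ≤ n → T i j ≡ S i j

sumTo : ℕ → (ℕ → ℤ) → ℤ
sumTo zero    f = + 0
sumTo (suc m) f = sumTo m f ℤ.+ f (suc m)

dualArray : TArray → TArray
dualArray T i j = - T i (suc i ∸ j)

weightAt : TArray → ℕ → ℤ
weightAt T i = sumTo i (T i) ℤ.- sumTo (i ∸ 1) (T (i ∸ 1))

IsGT : ℕ → TArray → Set
IsGT n T = ∀ i j → 1 ≤ j → j ≤ i → i < n →
           (T i j ℤ.≤ T (suc i) j) × (T (suc i) (suc j) ℤ.≤ T i j)

ε : TArray → ℕ → ℕ → ℤ
ε T i j = sumTo (j ∸ 1) (λ h → T (suc i) h ℤ.- (+ 2) ℤ.* T i h ℤ.+ T (i ∸ 1) h)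
          ℤ.+ (T (suc i) j ℤ.- T i j)

record InGZ {n} (α β γ : Vec ℤ n) (T : TArray) : Set where
  field
    gt       : IsGT n T
    type     : ∀ j → 1 ≤ j → j ≤ n → T n j ≡ atℤ α j
    weight   : ∀ i → 1 ≤ i → i ≤ n → weightAt T i ≡ atℤ β i
    exponent : ∀ i j → 1 ≤ j → j ≤ i → i < n →
               ε T i j ℤ.≤ atℤ γ i ℤ.- atℤ γ (suc i)

rowAt : ∀ {n} → Tableau n → ℕ → List ℕ
rowAt Vec.[] _ = []
rowAt (x Vec.∷ xs) zero = []
rowAt (x Vec.∷ xs) (suc zero) = x
rowAt (x Vec.∷ xs) (suc (suc i)) = rowAt xs (suc i)

countLe : ℕ → List ℕ → ℕ
countLe m row = length (filter (_≤? m) row)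

U : ∀ {n} → Vec ℕ n → Tableau n → TArray
U {n} μ L k j = + (at μ (n ∸ k ℕ.+ j) ℕ.+ countLe (n ∸ k) (rowAt L (n ∸ k ℕ.+ j)))

φ : ∀ {n} → Vec ℕ n → Tableau n → TArray
φ μ L = dualArray (U μ L)

module Submission where

-- The proof works with the fill array of a tableau L,
--   fill m R = μ_R + #{entries ≤ m in row R}        (0 ≤ m < R ≤ n),
-- the last column of row R filled by μ or by letters ≤ m.  By definition
-- φ(L)^{(k)}_h = − fill m R whenever k + m = n and h + R = n + 1, and we say
-- that a t-array T is represented by F when this holds with F for fill.  The
-- GZ conditions on T then read as conditions on F:
--   type        ↔  F 0 R = μ_R,
--   interlacing ↔  F m R ≤ F (m+1) R  and  F (m+1) (R+1) ≤ F m R,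
--   weight      ↔  a telescoping sum of F (for F = fill: the content),
--   exponent    ↔  a second difference of F (for F = fill: counting
--                  inequalities between letters a and a+1, i.e. Yamanouchi).

open import Defs
open import Data.Nat using (ℕ; _≤_)
open import Data.Vec using (Vec; lookup)
open import Data.Product using (_×_; Σ; _,_)
open import Relation.Binary.PropositionalEquality using (_≡_)

module Lists where
  open import Data.Nat using (ℕ; zero; suc; _+_; _∸_; _≤_; _<_; z≤n; s≤s; _≤?_; _⊓_)
  open import Data.Nat.Properties
  open import Data.List using (List; []; _∷_; length; filter; drop; _++_; replicate)
  open import Data.List.Properties using (filter-accept; filter-reject; filter-++; filter-all; filter-none; length-++; length-filter)
  open import Data.List.Relation.Unary.All as All using (All; []; _∷_)
  open import Data.List.Relation.Unary.All.Properties using (++⁺; replicate⁺)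
  open import Data.List.Relation.Unary.AllPairs using (AllPairs; []; _∷_)
  import Data.List.Relation.Unary.AllPairs.Properties as AllPairs
  open import Data.Maybe using (just)
  open import Relation.Binary.PropositionalEquality
  open import Relation.Nullary
  open import Data.Product
  open import Data.Empty

  count-hit : ∀ {k x} xs → x ≡ k → count k (x ∷ xs) ≡ suc (count k xs)
  count-hit {k} xs eq = cong length (filter-accept (_≟ k) eq)

  count-miss : ∀ {k x} xs → x ≢ k → count k (x ∷ xs) ≡ count k xs
  count-miss {k} xs ne = cong length (filter-reject (_≟ k) ne)

  countLe-hit : ∀ {m x} xs → x ≤ m → countLe m (x ∷ xs) ≡ suc (countLe m xs)
  countLe-hit {m} xs le = cong length (filter-accept (_≤? m) le)

  countLe-miss : ∀ {m x} xs → ¬ (x ≤ m) → countLe m (x ∷ xs) ≡ countLe m xs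
  countLe-miss {m} xs ne = cong length (filter-reject (_≤? m) ne)

  count-++ : ∀ k xs ys → count k (xs ++ ys) ≡ count k xs + count k ys
  count-++ k xs ys = trans (cong length (filter-++ (_≟ k) xs ys)) (length-++ (filter (_≟ k) xs))

  countLe-++ : ∀ m xs ys → countLe m (xs ++ ys) ≡ countLe m xs + countLe m ys
  countLe-++ m xs ys = trans (cong length (filter-++ (_≤? m) xs ys)) (length-++ (filter (_≤? m) xs))

  countLe-all : ∀ {m} xs → All (_≤ m) xs → countLe m xs ≡ length xs
  countLe-all {m} xs ps = cong length (filter-all (_≤? m) ps)

  countLe-none : ∀ {m} xs → All (m <_) xs → countLe m xs ≡ 0
  countLe-none {m} xs ps = cong length (filter-none (_≤? m) (All.map <⇒≱ ps))

  count-none : ∀ {k} xs → All (_≢ k) xs → count k xs ≡ 0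
  count-none {k} xs ps = cong length (filter-none (_≟ k) ps)

  countLe≤length : ∀ m xs → countLe m xs ≤ length xs
  countLe≤length m xs = length-filter (_≤? m) xs

  countLe-suc : ∀ w xs → countLe (suc w) xs ≡ countLe w xs + count (suc w) xs
  countLe-suc w [] = refl
  countLe-suc w (x ∷ xs) with x ≤? w | x ≟ suc w
  ... | yes x≤w | yes refl = ⊥-elim (1+n≰n x≤w)
  ... | yes x≤w | no x≢ = begin
    countLe (suc w) (x ∷ xs)                 ≡⟨ countLe-hit xs (m≤n⇒m≤1+n x≤w) ⟩
    suc (countLe (suc w) xs)                 ≡⟨ cong suc (countLe-suc w xs) ⟩
    suc (countLe w xs + count (suc w) xs)    ≡⟨ cong₂ _+_ (sym (countLe-hit xs x≤w)) (sym (count-miss xs x≢)) ⟩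
    countLe w (x ∷ xs) + count (suc w) (x ∷ xs) ∎
    where open ≡-Reasoning
  ... | no x≰w | yes refl = begin
    countLe (suc w) (x ∷ xs)                 ≡⟨ countLe-hit xs ≤-refl ⟩
    suc (countLe (suc w) xs)                 ≡⟨ cong suc (countLe-suc w xs) ⟩
    suc (countLe w xs + count (suc w) xs)    ≡⟨ sym (+-suc _ _) ⟩
    countLe w xs + suc (count (suc w) xs)    ≡⟨ cong₂ _+_ (sym (countLe-miss xs x≰w)) (sym (count-hit xs refl)) ⟩
    countLe w (x ∷ xs) + count (suc w) (x ∷ xs) ∎
    where open ≡-Reasoning
  ... | no x≰w | no x≢ = begin
    countLe (suc w) (x ∷ xs)                 ≡⟨ countLe-miss xs x≰sw ⟩
    countLe (suc w) xs                       ≡⟨ countLe-suc w xs ⟩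
    countLe w xs + count (suc w) xs          ≡⟨ cong₂ _+_ (sym (countLe-miss xs x≰w)) (sym (count-miss xs x≢)) ⟩
    countLe w (x ∷ xs) + count (suc w) (x ∷ xs) ∎
    where
    open ≡-Reasoning
    x≰sw : ¬ (x ≤ suc w)
    x≰sw x≤sw = x≢ (≤-antisym x≤sw (≰⇒> x≰w))

  countLe-mono : ∀ {w w'} xs → w ≤ w' → countLe w xs ≤ countLe w' xs
  countLe-mono [] le = z≤n
  countLe-mono {w} {w'} (x ∷ xs) le with x ≤? w | x ≤? w'
  ... | yes a | yes b = subst₂ _≤_ (sym (countLe-hit xs a)) (sym (countLe-hit xs b)) (s≤s (countLe-mono xs le))
  ... | yes a | no b = ⊥-elim (b (≤-trans a le))
  ... | no a | yes b = subst₂ _≤_ (sym (countLe-miss xs a)) (sym (countLe-hit xs b)) (m≤n⇒m≤1+n (countLe-mono xs le))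
  ... | no a | no b = subst₂ _≤_ (sym (countLe-miss xs a)) (sym (countLe-miss xs b)) (countLe-mono xs le)

  count-drop-≤ : ∀ k t xs → count k (drop t xs) ≤ count k xs
  count-drop-≤ k zero xs = ≤-refl
  count-drop-≤ k (suc t) [] = z≤n
  count-drop-≤ k (suc t) (x ∷ xs) with x ≟ k
  ... | yes e = subst (_ ≤_) (sym (count-hit xs e)) (m≤n⇒m≤1+n (count-drop-≤ k t xs))
  ... | no e = subst (_ ≤_) (sym (count-miss xs e)) (count-drop-≤ k t xs)

  nth-All : ∀ {P : ℕ → Set} {xs k x} → All P xs → nth xs k ≡ just x → P x
  nth-All {xs = x ∷ xs} {zero} (p ∷ ps) refl = p
  nth-All {xs = x ∷ xs} {suc k} (p ∷ ps) e = nth-All ps e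

  All-nth : ∀ {P : ℕ → Set} xs → (∀ k x → nth xs k ≡ just x → P x) → All P xs
  All-nth [] f = []
  All-nth (x ∷ xs) f = f 0 x refl ∷ All-nth xs (λ k y e → f (suc k) y e)

  nth-total : ∀ (xs : List ℕ) k → k < length xs → Σ ℕ λ x → nth xs k ≡ just x
  nth-total (x ∷ xs) zero lt = x , refl
  nth-total (x ∷ xs) (suc k) (s≤s lt) = nth-total xs k lt

  nth-length : ∀ (xs : List ℕ) k x → nth xs k ≡ just x → k < length xs
  nth-length (y ∷ xs) zero x e = s≤s z≤n
  nth-length (y ∷ xs) (suc k) x e = s≤s (nth-length xs k x e)

  nth-++ˡ : ∀ (xs ys : List ℕ) k → k < length xs → nth (xs ++ ys) k ≡ nth xs k
  nth-++ˡ (x ∷ xs) ys zero lt = refl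
  nth-++ˡ (x ∷ xs) ys (suc k) (s≤s lt) = nth-++ˡ xs ys k lt

  nth-++ʳ : ∀ (xs ys : List ℕ) k → nth (xs ++ ys) (length xs + k) ≡ nth ys k
  nth-++ʳ [] ys k = refl
  nth-++ʳ (x ∷ xs) ys k = nth-++ʳ xs ys k

  drop-++ : ∀ (ys zs : List ℕ) → drop (length ys) (ys ++ zs) ≡ zs
  drop-++ [] zs = refl
  drop-++ (y ∷ ys) zs = drop-++ ys zs

  drop-++ˡ : ∀ (xs ys : List ℕ) t → t ≤ length xs → drop t (xs ++ ys) ≡ drop t xs ++ ys
  drop-++ˡ xs ys zero le = refl
  drop-++ˡ (x ∷ xs) ys (suc t) (s≤s le) = drop-++ˡ xs ys t le

  drop-++ʳ : ∀ (xs ys : List ℕ) t → drop (length xs + t) (xs ++ ys) ≡ drop t ys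
  drop-++ʳ [] ys t = refl
  drop-++ʳ (x ∷ xs) ys t = drop-++ʳ xs ys t

  Sorted : List ℕ → Set
  Sorted = AllPairs _≤_

  -- Sortedness phrased positionally, as the row condition of an LR tableau is.
  SortedByPosition : List ℕ → Set
  SortedByPosition xs = ∀ k k' x y → k < k' → nth xs k ≡ just x → nth xs k' ≡ just y → x ≤ y

  sorted-from-positions : ∀ xs → SortedByPosition xs → Sorted xs
  sorted-from-positions [] f = []
  sorted-from-positions (x ∷ xs) f =
    All-nth xs (λ k y e → f 0 (suc k) x y (s≤s z≤n) refl e)
      ∷ sorted-from-positions xs (λ k k' a b lt e1 e2 → f (suc k) (suc k') a b (s≤s lt) e1 e2)

  sorted-positions : ∀ {xs} → Sorted xs → SortedByPosition xs
  sorted-positions (p ∷ s) zero (suc k') x y lt refl e2 = nth-All p e2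
  sorted-positions (p ∷ s) (suc k) (suc k') x y (s≤s lt) e1 e2 = sorted-positions s k k' x y lt e1 e2

  drop-head : ∀ {xs} → Sorted xs → ∀ k x → nth xs k ≡ just x → Σ (List ℕ) λ rest → drop k xs ≡ x ∷ rest × All (x ≤_) rest
  drop-head {x ∷ ys} (p ∷ s) zero x refl = ys , refl , p
  drop-head (p ∷ s) (suc k) x e = drop-head s k x e

  record Split (m : ℕ) (xs : List ℕ) : Set where
    constructor mkSplit
    field
      small large : List ℕ
      eq : xs ≡ small ++ large
      small≤ : All (_≤ m) small
      large> : All (m <_) large

  split : ∀ m {xs} → Sorted xs → Split m xs
  split m [] = mkSplit [] [] refl [] []
  split m {x ∷ xs} (p ∷ s) with x ≤? m | split m s
  ... | yes le | mkSplit ys zs eq a b = mkSplit (x ∷ ys) zs (cong (x ∷_) eq) (le ∷ a) b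
  ... | no gt | _ = mkSplit [] (x ∷ xs) refl [] (≰⇒> gt ∷ All.map (<-≤-trans (≰⇒> gt)) p)

  split-countLe : ∀ m {xs} (sp : Split m xs) → countLe m xs ≡ length (Split.small sp)
  split-countLe m (mkSplit ys zs refl a b) =
    trans (countLe-++ m ys zs) (trans (cong₂ _+_ (countLe-all ys a) (countLe-none zs b)) (+-identityʳ _))

  sorted-nth-le : ∀ m {xs} → Sorted xs → ∀ k x → k < countLe m xs → nth xs k ≡ just x → x ≤ m
  sorted-nth-le m s k x lt e with split m s
  ... | sp@(mkSplit ys zs refl a b) =
    nth-All a (trans (sym (nth-++ˡ ys zs k (subst (k <_) (split-countLe m sp) lt))) e)

  sorted-nth-gt : ∀ m {xs} → Sorted xs → ∀ k x → countLe m xs ≤ k → nth xs k ≡ just x → m < x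
  sorted-nth-gt m s k x le e with split m s
  ... | sp@(mkSplit ys zs refl a b) =
    let le' = subst (_≤ k) (split-countLe m sp) le in
    nth-All b (trans (sym (nth-++ʳ ys zs (k ∸ length ys)))
                     (trans (cong (nth (ys ++ zs)) (m+[n∸m]≡n le')) e))

  sorted-head≤ : ∀ {v y ys} → Sorted (y ∷ ys) → 1 ≤ countLe v (y ∷ ys) → y ≤ v
  sorted-head≤ {v} {y} {ys} (p ∷ s) le with y ≤? v
  ... | yes q = q
  ... | no q = ⊥-elim (<⇒≱ le (≤-reflexive (trans (countLe-miss ys q)
                   (countLe-none ys (All.map (<-≤-trans (≰⇒> q)) p)))))

  sorted-by-countLe : ∀ {xs ys} → Sorted xs → Sorted ys → (∀ v → countLe v xs ≡ countLe v ys) → xs ≡ ys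
  sorted-by-countLe [] [] f = refl
  sorted-by-countLe {ys = y ∷ ys} [] (p ∷ s) f = ⊥-elim (0≢1+n (trans (f y) (countLe-hit {y} {y} ys ≤-refl)))
  sorted-by-countLe {xs = x ∷ xs} (p ∷ s) [] f = ⊥-elim (0≢1+n (trans (sym (f x)) (countLe-hit {x} {x} xs ≤-refl)))
  sorted-by-countLe {x ∷ xs} {y ∷ ys} (p ∷ s) (q ∷ t) f =
    cong₂ _∷_ x≡y (sorted-by-countLe s t tails)
    where
    y≤x : y ≤ x
    y≤x = sorted-head≤ (q ∷ t) (subst (1 ≤_) (trans (sym (countLe-hit {x} {x} xs ≤-refl)) (f x)) (s≤s z≤n))
    x≤y : x ≤ y
    x≤y = sorted-head≤ (p ∷ s) (subst (1 ≤_) (trans (sym (countLe-hit {y} {y} ys ≤-refl)) (sym (f y))) (s≤s z≤n))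
    x≡y : x ≡ y
    x≡y = ≤-antisym x≤y y≤x
    tails : ∀ v → countLe v xs ≡ countLe v ys
    tails v with x ≤? v
    ... | yes a = suc-injective (trans (sym (countLe-hit xs a)) (trans (f v) (countLe-hit ys (subst (_≤ v) x≡y a))))
    ... | no a = trans (sym (countLe-miss xs a)) (trans (f v) (countLe-miss ys (λ b → a (subst (_≤ v) (sym x≡y) b))))

  rowOfCounts : (ℕ → ℕ) → ℕ → List ℕ
  rowOfCounts K zero = []
  rowOfCounts K (suc M) = rowOfCounts K M ++ replicate (K (suc M) ∸ K M) (suc M)

  countLe-replicate-hit : ∀ {w v} k → v ≤ w → countLe w (replicate k v) ≡ k
  countLe-replicate-hit k le = trans (countLe-all (replicate k _) (replicate⁺ k le)) (length-replicate k)
    where open import Data.List.Properties using (length-replicate)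

  countLe-replicate-miss : ∀ {w v} k → ¬ (v ≤ w) → countLe w (replicate k v) ≡ 0
  countLe-replicate-miss k gt = countLe-none (replicate k _) (replicate⁺ k (≰⇒> gt))

  MonotoneUpTo : (ℕ → ℕ) → ℕ → Set
  MonotoneUpTo K M = ∀ v → v < M → K v ≤ K (suc v)

  rowOfCounts-countLe : ∀ K M → K 0 ≡ 0 → MonotoneUpTo K M → ∀ w → countLe w (rowOfCounts K M) ≡ K (w ⊓ M)
  rowOfCounts-countLe K zero k0 mo w = trans (sym k0) (cong K (sym (⊓-zeroʳ w)))
  rowOfCounts-countLe K (suc M) k0 mo w with suc M ≤? w
  ... | yes le = trans (countLe-++ w (rowOfCounts K M) _) (begin
    countLe w (rowOfCounts K M) + countLe w (replicate (K (suc M) ∸ K M) (suc M))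
      ≡⟨ cong₂ _+_ (trans (IH w) (cong K (m≥n⇒m⊓n≡n (≤-trans (n≤1+n M) le))))
                   (countLe-replicate-hit (K (suc M) ∸ K M) le) ⟩
    K M + (K (suc M) ∸ K M)   ≡⟨ m+[n∸m]≡n (mo M ≤-refl) ⟩
    K (suc M)                 ≡⟨ cong K (sym (m≥n⇒m⊓n≡n le)) ⟩
    K (w ⊓ suc M)             ∎)
    where
    open ≡-Reasoning
    IH : ∀ w → countLe w (rowOfCounts K M) ≡ K (w ⊓ M)
    IH = rowOfCounts-countLe K M k0 (λ v lt → mo v (m≤n⇒m≤1+n lt))
  ... | no gt = trans (countLe-++ w (rowOfCounts K M) _) (begin
    countLe w (rowOfCounts K M) + countLe w (replicate (K (suc M) ∸ K M) (suc M))
      ≡⟨ cong₂ _+_ (trans (IH w) (cong K (m≤n⇒m⊓n≡m (≤-pred (≰⇒> gt)))))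
                   (countLe-replicate-miss (K (suc M) ∸ K M) gt) ⟩
    K w + 0                   ≡⟨ +-identityʳ _ ⟩
    K w                       ≡⟨ cong K (sym (m≤n⇒m⊓n≡m (<⇒≤ (≰⇒> gt)))) ⟩
    K (w ⊓ suc M)             ∎)
    where
    open ≡-Reasoning
    IH : ∀ w → countLe w (rowOfCounts K M) ≡ K (w ⊓ M)
    IH = rowOfCounts-countLe K M k0 (λ v lt → mo v (m≤n⇒m≤1+n lt))

  rowOfCounts-range : ∀ K M → All (λ x → 1 ≤ x × x ≤ M) (rowOfCounts K M)
  rowOfCounts-range K zero = []
  rowOfCounts-range K (suc M) = ++⁺ (All.map (map₂ m≤n⇒m≤1+n) (rowOfCounts-range K M))
                                   (replicate⁺ _ (s≤s z≤n , ≤-refl))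

  rowOfCounts-sorted : ∀ K M → Sorted (rowOfCounts K M)
  rowOfCounts-sorted K zero = []
  rowOfCounts-sorted K (suc M) =
    AllPairs.++⁺ (rowOfCounts-sorted K M) (replicate-sorted _)
      (All.map (λ r → replicate⁺ _ (m≤n⇒m≤1+n (proj₂ r))) (rowOfCounts-range K M))
    where
    replicate-sorted : ∀ {v} k → Sorted (replicate k v)
    replicate-sorted zero = []
    replicate-sorted (suc k) = replicate⁺ k ≤-refl ∷ replicate-sorted k

  rowOfCounts-length : ∀ K M → K 0 ≡ 0 → MonotoneUpTo K M → length (rowOfCounts K M) ≡ K M
  rowOfCounts-length K M k0 mo =
    trans (sym (countLe-all (rowOfCounts K M) (All.map proj₂ (rowOfCounts-range K M))))
          (trans (rowOfCounts-countLe K M k0 mo M) (cong K (⊓-idem M)))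


module Indexing where
  open import Data.Nat using (ℕ; zero; suc; _∸_; _≤_; z≤n; s≤s; _≤?_)
  open import Data.Nat.Properties
  open import Data.Integer using (ℤ; +_; -_)
  open import Data.Fin as Fin using (Fin; toℕ; fromℕ<)
  open import Data.Fin.Properties using (toℕ-fromℕ<)
  open import Data.Vec as Vec using (Vec; lookup; _∷ʳ_)
  open import Data.Vec.Properties using (reverse-∷)
  open import Relation.Binary.PropositionalEquality
  open import Relation.Nullary
  open import Data.Product

  rowAt-lookup : ∀ {n} (L : Tableau n) (i : Fin n) → rowAt L (suc (toℕ i)) ≡ lookup L i
  rowAt-lookup (x Vec.∷ L) Fin.zero = refl
  rowAt-lookup (x Vec.∷ L) (Fin.suc i) = rowAt-lookup L i

  at-lookup : ∀ {n} (v : Vec ℕ n) (i : Fin n) → at v (suc (toℕ i)) ≡ lookup v i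
  at-lookup (x Vec.∷ v) Fin.zero = refl
  at-lookup (x Vec.∷ v) (Fin.suc i) = at-lookup v i

  toFin : ∀ {n} r → 1 ≤ r → r ≤ n → Σ (Fin n) λ i → suc (toℕ i) ≡ r
  toFin (suc r) (s≤s _) le = fromℕ< le , cong suc (toℕ-fromℕ< le)

  pointwise-at : ∀ {n} (u v : Vec ℕ n) → (∀ i → lookup u i ≤ lookup v i) → ∀ R → 1 ≤ R → R ≤ n → at u R ≤ at v R
  pointwise-at u v u≤v R p q with toFin R p q
  ... | i , refl = subst₂ _≤_ (sym (at-lookup u i)) (sym (at-lookup v i)) (u≤v i)

  atℤ-map : ∀ {n} (f : ℕ → ℤ) (v : Vec ℕ n) i → 1 ≤ i → i ≤ n → atℤ (Vec.map f v) i ≡ f (at v i)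
  atℤ-map f (x Vec.∷ v) (suc zero) _ _ = refl
  atℤ-map f (x Vec.∷ v) (suc (suc i)) _ (s≤s le) = atℤ-map f v (suc i) (s≤s z≤n) le

  atℤ-zip : ∀ {n} (f : ℤ → ℤ → ℤ) (u v : Vec ℤ n) i → 1 ≤ i → i ≤ n →
            atℤ (Vec.zipWith f u v) i ≡ f (atℤ u i) (atℤ v i)
  atℤ-zip f (x Vec.∷ u) (y Vec.∷ v) (suc zero) _ _ = refl
  atℤ-zip f (x Vec.∷ u) (y Vec.∷ v) (suc (suc i)) _ (s≤s le) = atℤ-zip f u v (suc i) (s≤s z≤n) le

  at-snoc-lt : ∀ {n} (v : Vec ℕ n) x i → i ≤ n → at (v ∷ʳ x) i ≡ at v i
  at-snoc-lt Vec.[] x zero le = refl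
  at-snoc-lt (y Vec.∷ v) x zero le = refl
  at-snoc-lt (y Vec.∷ v) x (suc zero) le = refl
  at-snoc-lt (y Vec.∷ v) x (suc (suc i)) (s≤s le) = at-snoc-lt v x (suc i) le

  at-snoc-end : ∀ {n} (v : Vec ℕ n) x → at (v ∷ʳ x) (suc n) ≡ x
  at-snoc-end Vec.[] x = refl
  at-snoc-end (y Vec.∷ Vec.[]) x = refl
  at-snoc-end (y Vec.∷ (z Vec.∷ v)) x = at-snoc-end (z Vec.∷ v) x

  at-reverse : ∀ {n} (v : Vec ℕ n) i → 1 ≤ i → i ≤ n → at (Vec.reverse v) i ≡ at v (suc n ∸ i)
  at-reverse Vec.[] (suc i) (s≤s _) ()
  at-reverse {suc n} (x Vec.∷ v) i 1≤i i≤n rewrite reverse-∷ x v with i ≤? n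
  ... | yes le = trans (at-snoc-lt (Vec.reverse v) x i le)
                 (trans (at-reverse v i 1≤i le)
                 (trans (cong (at v) (+-∸-assoc 1 le))
                 (cong (at (x Vec.∷ v)) (sym (+-∸-assoc 2 le)))))
  ... | no gt with ≤-antisym i≤n (≰⇒> gt)
  ...   | refl = trans (at-snoc-end (Vec.reverse v) x)
                   (cong (at (x Vec.∷ v)) (sym (trans (+-∸-assoc 1 {n} {n} ≤-refl) (cong suc (n∸n≡0 n)))))

  at-dual : ∀ {n} (w : Vec ℕ n) i → 1 ≤ i → i ≤ n → atℤ (dual w) i ≡ - (+ at w (suc n ∸ i))
  at-dual w i p q = trans (atℤ-map (λ x → - (+ x)) (Vec.reverse w) i p q) (cong (λ z → - (+ z)) (at-reverse w i p q))

module ReadingWord where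
  open Lists
  open import Data.Nat using (ℕ; zero; suc; _+_; _∸_; _≤_; _<_; z≤n; s≤s; _≤?_)
  open import Data.Nat.Properties
  open import Data.Vec as Vec using (Vec; lookup)
  open import Data.List as List using (List; []; _∷_; length; drop; _++_; concat)
  open import Data.List.Properties using (++-assoc; ++-identityʳ; unfold-reverse; concat-++; drop-[])
  open import Data.List.Relation.Unary.All as All using (All)
  open import Data.Maybe using (just)
  open import Relation.Binary.PropositionalEquality
  open import Relation.Nullary
  open import Data.Product
  open import Data.Sum using (_⊎_; inj₁; inj₂)
  open import Data.Empty

  rowsUp : ∀ {n} → Tableau n → ℕ → List ℕ
  rowsUp L zero = []
  rowsUp L (suc k) = rowAt L (suc k) ++ rowsUp L k

  rowsUp-∷ : ∀ {n} x (xs : Tableau n) k → rowsUp (x Vec.∷ xs) (suc k) ≡ rowsUp xs k ++ x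
  rowsUp-∷ x xs zero = ++-identityʳ x
  rowsUp-∷ x xs (suc k) = trans (cong (rowAt xs (suc k) ++_) (rowsUp-∷ x xs k)) (sym (++-assoc (rowAt xs (suc k)) (rowsUp xs k) x))

  readingWord≡rowsUp : ∀ {n} (L : Tableau n) → readingWord L ≡ rowsUp L n
  readingWord≡rowsUp Vec.[] = refl
  readingWord≡rowsUp {suc n} (x Vec.∷ xs) =
    trans (cong concat (unfold-reverse x (Vec.toList xs)))
    (trans (sym (concat-++ (List.reverse (Vec.toList xs)) (x ∷ [])))
    (trans (cong₂ _++_ (readingWord≡rowsUp xs) (++-identityʳ x)) (sym (rowsUp-∷ x xs n))))

  skip-row : ∀ {n} (L : Tableau n) k s → length (rowAt L (suc k)) < s →
             drop s (rowsUp L (suc k)) ≡ drop (s ∸ length (rowAt L (suc k))) (rowsUp L k)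
  skip-row L k s lt = trans (cong (λ z → drop z (rowsUp L (suc k))) (sym (m+[n∸m]≡n (<⇒≤ lt))))
                            (drop-++ʳ (rowAt L (suc k)) (rowsUp L k) _)

  SuffixFromRow : ∀ {n} → Tableau n → ℕ → List ℕ → Set
  SuffixFromRow L k w = Σ ℕ λ r → Σ ℕ λ t → 1 ≤ r × r ≤ k × w ≡ drop t (rowAt L r) ++ rowsUp L (r ∸ 1)

  suffix-of-rowsUp : ∀ {n} (L : Tableau n) k s → drop s (rowsUp L k) ≡ [] ⊎ SuffixFromRow L k (drop s (rowsUp L k))
  suffix-of-rowsUp L zero s = inj₁ (drop-[] s)
  suffix-of-rowsUp L (suc k) s with s ≤? length (rowAt L (suc k))
  ... | yes le = inj₂ (suc k , s , s≤s z≤n , ≤-refl , drop-++ˡ (rowAt L (suc k)) (rowsUp L k) s le)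
  ... | no gt with suffix-of-rowsUp L k (s ∸ length (rowAt L (suc k)))
  ...   | inj₁ e = inj₁ (trans (skip-row L k s (≰⇒> gt)) e)
  ...   | inj₂ (r , t , a , b , e) = inj₂ (r , t , a , m≤n⇒m≤1+n b , trans (skip-row L k s (≰⇒> gt)) e)

  rowsUp-split : ∀ {n} (L : Tableau n) k r → 1 ≤ r → r ≤ k → Σ (List ℕ) λ pre → rowsUp L k ≡ pre ++ (rowAt L r ++ rowsUp L (r ∸ 1))
  rowsUp-split L zero (suc r) (s≤s _) ()
  rowsUp-split L (suc k) r p q with r ≟ suc k
  ... | yes refl = [] , refl
  ... | no ne with rowsUp-split L k r p (≤-pred (≤∧≢⇒< q ne))
  ...   | pre , e = rowAt L (suc k) ++ pre , trans (cong (rowAt L (suc k) ++_) e) (sym (++-assoc (rowAt L (suc k)) pre _))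

  suffix-from-box : ∀ {n} (L : Tableau n) k r t → 1 ≤ r → r ≤ k → t ≤ length (rowAt L r) →
              Σ ℕ λ s → drop s (rowsUp L k) ≡ drop t (rowAt L r) ++ rowsUp L (r ∸ 1)
  suffix-from-box L k r t p q le with rowsUp-split L k r p q
  ... | pre , e = length pre + t , trans (cong (drop (length pre + t)) e)
                    (trans (drop-++ʳ pre _ t) (drop-++ˡ (rowAt L r) _ t le))

  countRows : ∀ {n} → Tableau n → ℕ → ℕ → ℕ
  countRows L v k = count v (rowsUp L k)

  countRows-suc : ∀ {n} (L : Tableau n) v k → countRows L v (suc k) ≡ count v (rowAt L (suc k)) + countRows L v k
  countRows-suc L v k = count-++ v (rowAt L (suc k)) (rowsUp L k)

  countRows-absent : ∀ {n} (L : Tableau n) v k → (∀ R → 1 ≤ R → R ≤ k → All (_< v) (rowAt L R)) → countRows L v k ≡ 0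
  countRows-absent L v zero f = refl
  countRows-absent L v (suc k) f = trans (countRows-suc L v k)
    (cong₂ _+_ (count-none _ (All.map (λ p e → <-irrefl e p) (f (suc k) (s≤s z≤n) ≤-refl)))
               (countRows-absent L v k (λ R a b → f R a (m≤n⇒m≤1+n b))))

  entry-inv : ∀ {n} (μ : Vec ℕ n) (L : Tableau n) r c x → entry μ L r c ≡ just x →
              lookup μ r < c × nth (lookup L r) (c ∸ suc (lookup μ r)) ≡ just x
  entry-inv μ L r c x e with c ≤? lookup μ r
  ... | yes _ = case e of λ ()
    where open import Function using (case_of_)
  ... | no gt = ≰⇒> gt , e

  entry-eq : ∀ {n} (μ : Vec ℕ n) (L : Tableau n) r c → lookup μ r < c →
             entry μ L r c ≡ nth (lookup L r) (c ∸ suc (lookup μ r))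
  entry-eq μ L r c lt with c ≤? lookup μ r
  ... | yes le = ⊥-elim (<⇒≱ lt le)
  ... | no gt = refl

-- Linear index arithmetic: rows and columns of a t-array are matched with
-- rows and columns of the array it represents through equations k + m ≡ n
-- and h + R ≡ n + 1.
module IndexArithmetic where
  open import Data.Nat using (suc; _+_; _∸_; _≤_; s≤s)
  open import Data.Nat.Properties using (+-cancelˡ-≤; +-monoˡ-≤; ≤-trans; ≤-reflexive; m≤n+m; suc-injective; +-∸-assoc; m∸n+n≡m; n≤1+n)
  open import Relation.Binary.PropositionalEquality

  summand≤ : ∀ {k m n} → k + m ≡ n → m ≤ n
  summand≤ {k} {m} e = subst (m ≤_) e (m≤n+m m k)

  shift-≤ : ∀ {a b c e} → a ≤ b → b + c ≡ a + e → c ≤ e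
  shift-≤ {a} {b} {c} {e} a≤b eq = +-cancelˡ-≤ a c e (≤-trans (+-monoˡ-≤ c a≤b) (≤-reflexive eq))

  column≤ : ∀ {h R n} → 1 ≤ h → h + R ≡ suc n → R ≤ n
  column≤ (s≤s _) e = summand≤ (suc-injective e)

  complement-suc : ∀ {m n} → suc m ≤ n → suc (n ∸ suc m) + m ≡ n
  complement-suc {m} sm≤n = trans (cong (_+ m) (sym (+-∸-assoc 1 sm≤n))) (m∸n+n≡m (≤-trans (n≤1+n m) sm≤n))

module RepresentedArrays where
  open Indexing
  open IndexArithmetic
  open import Data.Nat as ℕ using (ℕ; zero; suc; _∸_; z≤n; s≤s)
  open import Data.Nat.Properties as ℕP using (+-∸-assoc; m+n∸m≡n; m+[n∸m]≡n; m∸n+n≡m; m≤n⇒m≤1+n; ≤-trans; ≤-refl; n≤1+n; +-suc; m≤m+n; +-identityʳ; +-comm; ∸-monoˡ-≤)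
  open import Data.Integer as ℤ using (ℤ; +_; -_; _+_; _-_; _*_)
  open import Data.Integer.Properties using (neg-distrib-+; *-distribˡ-+; *-zeroʳ; +-inverseʳ; neg-involutive; neg-mono-≤)
  open import Data.Integer.Tactic.RingSolver
  open import Data.Vec using (Vec)
  open import Data.Product using (_×_; _,_; proj₁; proj₂)
  open import Relation.Binary.PropositionalEquality

  sumTo-cong : ∀ k (f g : ℕ → ℤ) → (∀ h → 1 ℕ.≤ h → h ℕ.≤ k → f h ≡ g h) → sumTo k f ≡ sumTo k g
  sumTo-cong zero f g e = refl
  sumTo-cong (suc k) f g e = cong₂ _+_ (sumTo-cong k f g (λ h p h≤k → e h p (m≤n⇒m≤1+n h≤k))) (e (suc k) (s≤s z≤n) ≤-refl)

  sumTo-neg : ∀ k (f : ℕ → ℤ) → sumTo k (λ h → - f h) ≡ - sumTo k f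
  sumTo-neg zero f = refl
  sumTo-neg (suc k) f = trans (cong (_+ (- f (suc k))) (sumTo-neg k f)) (sym (neg-distrib-+ (sumTo k f) (f (suc k))))

  sumTo-+ : ∀ k (f g : ℕ → ℤ) → sumTo k (λ h → f h + g h) ≡ sumTo k f + sumTo k g
  sumTo-+ zero f g = refl
  sumTo-+ (suc k) f g = trans (cong (_+ (f (suc k) + g (suc k))) (sumTo-+ k f g)) (interchange (sumTo k f) (sumTo k g) (f (suc k)) (g (suc k)))
    where
    interchange : ∀ a b a' b' → (a + b) + (a' + b') ≡ (a + a') + (b + b')
    interchange = solve-∀

  sumTo-scale : ∀ k c (f : ℕ → ℤ) → sumTo k (λ h → c * f h) ≡ c * sumTo k f
  sumTo-scale zero c f = sym (*-zeroʳ c)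
  sumTo-scale (suc k) c f = trans (cong (_+ c * f (suc k)) (sumTo-scale k c f)) (sym (*-distribˡ-+ c (sumTo k f) (f (suc k))))

  sumBetween : (ℕ → ℤ) → ℕ → ℕ → ℤ
  sumBetween f a b = sumTo b f - sumTo a f

  sumTo-reversed : ∀ n k (g : ℕ → ℤ) → k ℕ.≤ n → sumTo k (λ h → g (suc n ∸ h)) ≡ sumBetween g (n ∸ k) n
  sumTo-reversed n zero g _ = sym (+-inverseʳ (sumTo n g))
  sumTo-reversed (suc n) (suc k) g (s≤s le) =
    trans (cong (_+ g (suc n ∸ k)) (sumTo-reversed (suc n) k g (m≤n⇒m≤1+n le)))
    (trans (cong (λ z → (sumTo (suc n) g - sumTo z g) + g z) (+-∸-assoc 1 le))
    (peel (sumTo (suc n) g) (sumTo (n ∸ k) g) (g (suc (n ∸ k)))))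
    where
    peel : ∀ a b c → (a - (b + c)) + c ≡ a - b
    peel = solve-∀

  -- T is represented by F when T^{(k)}_h = − F m R whenever k + m = n and
  -- h + R = n + 1: rows of T are the reversed, negated rows of F, in reverse order.
  record Represents (n : ℕ) (T : TArray) (F : ℕ → ℕ → ℤ) : Set where
    constructor represents
    field entryOf : ∀ {k m h R} → k ℕ.+ m ≡ n → h ℕ.+ R ≡ suc n → h ℕ.≤ k → T k h ≡ - F m R
  open Represents public

  valueOf : ∀ {n T F} → Represents n T F → ∀ {k m h R} → k ℕ.+ m ≡ n → h ℕ.+ R ≡ suc n → h ℕ.≤ k → F m R ≡ - T k h
  valueOf rep ek eh h≤k = trans (sym (neg-involutive _)) (cong -_ (sym (entryOf rep ek eh h≤k)))

  sumTo-represented-row : ∀ {n T F} → Represents n T F → ∀ k m → k ℕ.+ m ≡ n →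
                          sumTo k (T k) ≡ - sumBetween (F m) m n
  sumTo-represented-row {n} {T} {F} rep k m e =
    trans (sumTo-cong k (T k) (λ h → - F m (suc n ∸ h))
            (λ h _ h≤k → entryOf rep e (m+[n∸m]≡n (≤-trans h≤k (≤-trans k≤n (n≤1+n n)))) h≤k))
    (trans (sumTo-neg k (λ h → F m (suc n ∸ h)))
           (cong -_ (trans (sumTo-reversed n k (F m) k≤n) (cong (λ z → sumBetween (F m) z n) n∸k≡m))))
    where
    k≤n : k ℕ.≤ n
    k≤n = subst (k ℕ.≤_) e (m≤m+n k m)
    n∸k≡m : n ∸ k ≡ m
    n∸k≡m = trans (cong (_∸ k) (sym e)) (m+n∸m≡n k m)

  weightExpr : ℕ → (ℕ → ℕ → ℤ) → ℕ → ℤ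
  weightExpr n F m = - sumBetween (F m) m n + sumBetween (F (suc m)) (suc m) n

  weight-via-represent : ∀ {n T F} → Represents n T F → ∀ i m → suc i ℕ.+ m ≡ n →
    weightAt T (suc i) ≡ weightExpr n F m
  weight-via-represent {n} {T} {F} rep i m e =
    trans (cong₂ _-_ (sumTo-represented-row rep (suc i) m e)
                     (sumTo-represented-row rep i (suc m) (trans (+-suc i m) e)))
          (neg-minus-neg (sumBetween (F m) m n) (sumBetween (F (suc m)) (suc m) n))
    where
    neg-minus-neg : ∀ x y → - x - - y ≡ - x + y
    neg-minus-neg = solve-∀

  exponentExpr : ℕ → (ℕ → ℕ → ℤ) → ℕ → ℕ → ℤ
  exponentExpr n F m r =
    (- sumBetween (F m) r n + (+ 2) * sumBetween (F (suc m)) r n + - sumBetween (F (suc (suc m))) r n)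
    + (- F m r - - F (suc m) r)

  exponent-via-represent : ∀ {n T F} → Represents n T F → ∀ i j m → suc i ℕ.+ suc m ≡ n → j ℕ.≤ i →
    ε T (suc i) (suc j) ≡ exponentExpr n F m (n ∸ j)
  exponent-via-represent {n} {T} {F} rep i j m e j≤i = cong₂ _+_ columnSums lastTerm
    where
    e₀ : suc (suc i) ℕ.+ m ≡ n
    e₀ = trans (sym (+-suc (suc i) m)) e
    e₂ : i ℕ.+ suc (suc m) ≡ n
    e₂ = trans (+-suc i (suc m)) e
    j≤n : j ℕ.≤ n
    j≤n = ≤-trans j≤i (summand≤ (trans (ℕP.+-comm (suc (suc m)) i) e₂))
    column : ∀ h → 1 ℕ.≤ h → h ℕ.≤ j →
      T (suc (suc i)) h - (+ 2) * T (suc i) h + T i h ≡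
      - F m (suc n ∸ h) + (+ 2) * F (suc m) (suc n ∸ h) + - F (suc (suc m)) (suc n ∸ h)
    column h _ h≤j =
      trans (cong₂ _+_ (cong₂ (λ a b → a - (+ 2) * b)
                              (entryOf rep e₀ eh (≤-trans h≤i (≤-trans (n≤1+n i) (n≤1+n (suc i)))))
                              (entryOf rep e eh (≤-trans h≤i (n≤1+n i))))
                       (entryOf rep e₂ eh h≤i))
            (second-difference (F m (suc n ∸ h)) (F (suc m) (suc n ∸ h)) (F (suc (suc m)) (suc n ∸ h)))
      where
      h≤i : h ℕ.≤ i
      h≤i = ≤-trans h≤j j≤i
      eh : h ℕ.+ (suc n ∸ h) ≡ suc n
      eh = m+[n∸m]≡n (≤-trans h≤j (≤-trans j≤n (n≤1+n n)))
      second-difference : ∀ x y z → - x - (+ 2) * (- y) + - z ≡ - x + (+ 2) * y + - z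
      second-difference = solve-∀
    reversedColumn : ∀ x → sumTo j (λ h → F x (suc n ∸ h)) ≡ sumBetween (F x) (n ∸ j) n
    reversedColumn x = sumTo-reversed n j (F x) j≤n
    negColumn : ∀ x → sumTo j (λ h → - F x (suc n ∸ h)) ≡ - sumBetween (F x) (n ∸ j) n
    negColumn x = trans (sumTo-neg j (λ h → F x (suc n ∸ h))) (cong -_ (reversedColumn x))
    columnSums : sumTo j (λ h → T (suc (suc i)) h - (+ 2) * T (suc i) h + T i h) ≡
      - sumBetween (F m) (n ∸ j) n + (+ 2) * sumBetween (F (suc m)) (n ∸ j) n + - sumBetween (F (suc (suc m))) (n ∸ j) n
    columnSums = begin
      sumTo j (λ h → T (suc (suc i)) h - (+ 2) * T (suc i) h + T i h)
        ≡⟨ sumTo-cong j _ _ column ⟩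
      sumTo j (λ h → (- F m (suc n ∸ h) + (+ 2) * F (suc m) (suc n ∸ h)) + - F (suc (suc m)) (suc n ∸ h))
        ≡⟨ sumTo-+ j _ _ ⟩
      sumTo j (λ h → - F m (suc n ∸ h) + (+ 2) * F (suc m) (suc n ∸ h)) + sumTo j (λ h → - F (suc (suc m)) (suc n ∸ h))
        ≡⟨ cong₂ _+_ (sumTo-+ j _ _) (negColumn (suc (suc m))) ⟩
      sumTo j (λ h → - F m (suc n ∸ h)) + sumTo j (λ h → (+ 2) * F (suc m) (suc n ∸ h)) + - sumBetween (F (suc (suc m))) (n ∸ j) n
        ≡⟨ cong (λ z → z + - sumBetween (F (suc (suc m))) (n ∸ j) n)
                (cong₂ _+_ (negColumn m) (trans (sumTo-scale j (+ 2) _) (cong ((+ 2) *_) (reversedColumn (suc m))))) ⟩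
      - sumBetween (F m) (n ∸ j) n + (+ 2) * sumBetween (F (suc m)) (n ∸ j) n + - sumBetween (F (suc (suc m))) (n ∸ j) n ∎
      where open ≡-Reasoning
    lastTerm : T (suc (suc i)) (suc j) - T (suc i) (suc j) ≡ - F m (n ∸ j) - - F (suc m) (n ∸ j)
    lastTerm = cong₂ _-_ (entryOf rep e₀ ej (s≤s (≤-trans j≤i (n≤1+n i))))
                         (entryOf rep e ej (s≤s j≤i))
      where
      ej : suc j ℕ.+ (n ∸ j) ≡ suc n
      ej = cong suc (m+[n∸m]≡n j≤n)

  exponent-on-diagonal : ∀ n F m → exponentExpr n F m (suc (suc m)) ≡
    (weightExpr n F m - weightExpr n F (suc m)) + (F m (suc m) - F (suc m) (suc (suc m)))
  exponent-on-diagonal n F m = regroup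
    (sumTo n (F m)) (sumTo n (F (suc m))) (sumTo n (F (suc (suc m))))
    (sumTo m (F m)) (sumTo m (F (suc m))) (sumTo m (F (suc (suc m))))
    (F m (suc m)) (F (suc m) (suc m)) (F (suc (suc m)) (suc m))
    (F m (suc (suc m))) (F (suc m) (suc (suc m))) (F (suc (suc m)) (suc (suc m)))
    where
    regroup : ∀ A₀ A₁ A₂ P₀ P₁ P₂ x₀ x₁ x₂ y₀ y₁ y₂ →
      (- (A₀ - (P₀ + x₀ + y₀)) + (+ 2) * (A₁ - (P₁ + x₁ + y₁)) + - (A₂ - (P₂ + x₂ + y₂))) + (- y₀ - - y₁)
      ≡ ((- (A₀ - P₀) + (A₁ - (P₁ + x₁))) - (- (A₁ - (P₁ + x₁)) + (A₂ - (P₂ + x₂ + y₂)))) + (x₀ - y₁)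
    regroup = solve-∀

  type-from-represent : ∀ {n T F} (μ : Vec ℕ n) → Represents n T F →
    (∀ R → 1 ℕ.≤ R → R ℕ.≤ n → F 0 R ≡ + at μ R) → ∀ j → 1 ℕ.≤ j → j ℕ.≤ n → T n j ≡ atℤ (dual μ) j
  type-from-represent {n} μ rep row0 j 1≤j j≤n =
    trans (entryOf rep (+-identityʳ n) ej j≤n)
          (trans (cong -_ (row0 (suc n ∸ j) (ℕP.m<n⇒0<n∸m (s≤s j≤n)) (column≤ 1≤j ej))) (sym (at-dual μ j 1≤j j≤n)))
    where
    ej : j ℕ.+ (suc n ∸ j) ≡ suc n
    ej = m+[n∸m]≡n (m≤n⇒m≤1+n j≤n)

  represent-from-type : ∀ {n T F} (μ : Vec ℕ n) → Represents n T F →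
    (∀ j → 1 ℕ.≤ j → j ℕ.≤ n → T n j ≡ atℤ (dual μ) j) → ∀ R → 1 ℕ.≤ R → R ℕ.≤ n → F 0 R ≡ + at μ R
  represent-from-type {n} μ rep type R 1≤R R≤n =
    trans (valueOf rep (+-identityʳ n) eR j≤n)
    (trans (cong -_ (type j 1≤j j≤n))
    (trans (cong -_ (at-dual μ j 1≤j j≤n))
    (trans (neg-involutive _) (cong (λ z → + at μ z) (ℕP.m∸[m∸n]≡n (m≤n⇒m≤1+n R≤n))))))
    where
    j = suc n ∸ R
    eR : j ℕ.+ R ≡ suc n
    eR = m∸n+n≡m (m≤n⇒m≤1+n R≤n)
    1≤j : 1 ℕ.≤ j
    1≤j = ℕP.m<n⇒0<n∸m (s≤s R≤n)
    j≤n : j ℕ.≤ n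
    j≤n = ℕP.∸-monoʳ-≤ (suc n) 1≤R

  -- Interlacing of T, read in F: rows of F grow, and F decreases along diagonals.
  RowsGrow : ℕ → (ℕ → ℕ → ℤ) → Set
  RowsGrow n F = ∀ m R → suc (suc m) ℕ.≤ R → R ℕ.≤ n → F m R ℤ.≤ F (suc m) R

  DiagonalsShrink : ℕ → (ℕ → ℕ → ℤ) → Set
  DiagonalsShrink n F = ∀ m R → m ℕ.< R → suc R ℕ.≤ n → F (suc m) (suc R) ℤ.≤ F m R

  gt-from-represent : ∀ {n T F} → Represents n T F → RowsGrow n F → DiagonalsShrink n F → IsGT n T
  gt-from-represent {n} {T} {F} rep grow shrink i j 1≤j j≤i i<n = rowStep , diagonalStep
    where
    m = n ∸ suc i
    e : suc i ℕ.+ m ≡ n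
    e = m+[n∸m]≡n i<n
    e' : i ℕ.+ suc m ≡ n
    e' = trans (+-suc i m) e
    R = suc n ∸ j
    eR : j ℕ.+ R ≡ suc n
    eR = m+[n∸m]≡n (≤-trans j≤i (≤-trans (n≤1+n i) (≤-trans i<n (n≤1+n n))))
    rowStep : T i j ℤ.≤ T (suc i) j
    rowStep = subst₂ ℤ._≤_ (sym (entryOf rep e' eR j≤i)) (sym (entryOf rep e eR (m≤n⇒m≤1+n j≤i)))
      (neg-mono-≤ (grow m R (shift-≤ j≤i (trans (+-suc i (suc m)) (trans (cong suc e') (sym eR)))) (column≤ 1≤j eR)))
    R' = n ∸ j
    eR' : suc j ℕ.+ R' ≡ suc n
    eR' = cong suc (m+[n∸m]≡n (≤-trans j≤i (≤-trans (n≤1+n i) i<n)))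
    diagonalStep : T (suc i) (suc j) ℤ.≤ T i j
    diagonalStep = subst₂ ℤ._≤_ (sym (entryOf rep e eR' (s≤s j≤i))) (sym (entryOf rep e' (trans (+-suc j R') eR') j≤i))
      (neg-mono-≤ (shrink m R' (shift-≤ j≤i (trans e' (sym (ℕP.suc-injective eR'))))
                               (column≤ 1≤j (trans (+-suc j R') eR'))))

  represent-from-gt : ∀ {n T F} → Represents n T F → IsGT n T → RowsGrow n F × DiagonalsShrink n F
  represent-from-gt {n} {T} {F} rep gt = grow , shrink
    where
    -- rows i+1 and i of T hold rows m and m+1 of F
    i : ℕ → ℕ
    i m = n ∸ suc m
    grow : RowsGrow n F
    grow m R 2+m≤R R≤n = subst₂ ℤ._≤_
        (sym (valueOf rep e eR (m≤n⇒m≤1+n j≤i))) (sym (valueOf rep e' eR j≤i))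
        (neg-mono-≤ (proj₁ (gt (i m) j (ℕP.m<n⇒0<n∸m (s≤s R≤n)) j≤i i<n)))
      where
      sm≤n : suc m ℕ.≤ n
      sm≤n = ≤-trans (n≤1+n (suc m)) (≤-trans 2+m≤R R≤n)
      e : suc (i m) ℕ.+ m ≡ n
      e = complement-suc sm≤n
      e' : i m ℕ.+ suc m ≡ n
      e' = trans (+-suc (i m) m) e
      j = suc n ∸ R
      eR : j ℕ.+ R ≡ suc n
      eR = m∸n+n≡m (m≤n⇒m≤1+n R≤n)
      j≤i : j ℕ.≤ i m
      j≤i = ℕP.∸-monoʳ-≤ (suc n) 2+m≤R
      i<n : i m ℕ.< n
      i<n = summand≤ (trans (ℕP.+-comm m (suc (i m))) e)
    shrink : DiagonalsShrink n F
    shrink m R m<R sR≤n = subst₂ ℤ._≤_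
        (sym (valueOf rep e' eR j≤i)) (sym (valueOf rep e (cong suc eR') (s≤s j≤i)))
        (neg-mono-≤ (proj₂ (gt (i m) j 1≤j j≤i i<n)))
      where
      sm≤n : suc m ℕ.≤ n
      sm≤n = ≤-trans m<R (≤-trans (n≤1+n R) sR≤n)
      e : suc (i m) ℕ.+ m ≡ n
      e = complement-suc sm≤n
      e' : i m ℕ.+ suc m ≡ n
      e' = trans (+-suc (i m) m) e
      j = n ∸ R
      eR' : j ℕ.+ R ≡ n
      eR' = m∸n+n≡m (≤-trans (n≤1+n R) sR≤n)
      eR : j ℕ.+ suc R ≡ suc n
      eR = trans (+-suc j R) (cong suc eR')
      1≤j : 1 ℕ.≤ j
      1≤j = ℕP.m<n⇒0<n∸m sR≤n
      j≤i : j ℕ.≤ i m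
      j≤i = ℕP.∸-monoʳ-≤ n m<R
      i<n : i m ℕ.< n
      i<n = summand≤ (trans (ℕP.+-comm m (suc (i m))) e)

  -- Weight and exponents only read entries 1 ≤ h ≤ k ≤ n, so they respect ≈[ n ].
  weightAt-cong : ∀ {n T S} → T ≈[ n ] S → ∀ i → i ℕ.≤ n → weightAt T i ≡ weightAt S i
  weightAt-cong {n} {T} {S} T≈S i i≤n = cong₂ _-_
    (sumTo-cong i (T i) (S i) (λ h p q → T≈S i h p q i≤n))
    (sumTo-cong (i ∸ 1) (T (i ∸ 1)) (S (i ∸ 1)) (λ h p q → T≈S (i ∸ 1) h p q (≤-trans (ℕP.m∸n≤m i 1) i≤n)))

  ε-cong : ∀ {n T S} → T ≈[ n ] S → ∀ i j → 1 ℕ.≤ j → j ℕ.≤ i → i ℕ.< n → ε T i j ≡ ε S i j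
  ε-cong {n} {T} {S} T≈S i j 1≤j j≤i i<n = cong₂ _+_
    (sumTo-cong (j ∸ 1) _ _ (λ h p q → cong₂ _+_
      (cong₂ (λ a b → a - (+ 2) * b) (T≈S (suc i) h p (≤-trans q (≤-trans (ℕP.m∸n≤m j 1) (≤-trans j≤i (n≤1+n i)))) i<n)
                                      (T≈S i h p (≤-trans q (≤-trans (ℕP.m∸n≤m j 1) j≤i)) i≤n))
      (T≈S (i ∸ 1) h p (≤-trans q (∸-monoˡ-≤ 1 j≤i)) (≤-trans (ℕP.m∸n≤m i 1) i≤n))))
    (cong₂ _-_ (T≈S (suc i) j 1≤j (≤-trans j≤i (n≤1+n i)) i<n) (T≈S i j 1≤j j≤i i≤n))
    where
    i≤n : i ℕ.≤ n
    i≤n = ≤-trans (n≤1+n i) i<n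

  agree-from-≈ : ∀ {n T S F G} → Represents n T F → Represents n S G → T ≈[ n ] S →
                 ∀ m R → m ℕ.< R → R ℕ.≤ n → F m R ≡ G m R
  agree-from-≈ {n} {T} {S} repT repS T≈S m R m<R R≤n =
    trans (valueOf repT ek eh h≤k) (trans (cong -_ (T≈S k h 1≤h h≤k (ℕP.m∸n≤m n m))) (sym (valueOf repS ek eh h≤k)))
    where
    k = n ∸ m
    h = suc n ∸ R
    ek : k ℕ.+ m ≡ n
    ek = m∸n+n≡m (≤-trans (n≤1+n m) (≤-trans m<R R≤n))
    eh : h ℕ.+ R ≡ suc n
    eh = m∸n+n≡m (m≤n⇒m≤1+n R≤n)
    1≤h : 1 ℕ.≤ h
    1≤h = ℕP.m<n⇒0<n∸m (s≤s R≤n)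
    h≤k : h ℕ.≤ k
    h≤k = ℕP.∸-monoʳ-≤ (suc n) m<R

  ≈-from-agree : ∀ {n T S F G} → Represents n T F → Represents n S G →
                 (∀ m R → m ℕ.< R → R ℕ.≤ n → F m R ≡ G m R) → T ≈[ n ] S
  ≈-from-agree {n} repT repS agree i j 1≤j j≤i i≤n =
    trans (entryOf repT ei ej j≤i) (trans (cong -_ (agree (n ∸ i) (suc n ∸ j) m<R (column≤ 1≤j ej))) (sym (entryOf repS ei ej j≤i)))
    where
    ei : i ℕ.+ (n ∸ i) ≡ n
    ei = m+[n∸m]≡n i≤n
    ej : j ℕ.+ (suc n ∸ j) ≡ suc n
    ej = m+[n∸m]≡n (≤-trans j≤i (m≤n⇒m≤1+n i≤n))
    m<R : n ∸ i ℕ.< suc n ∸ j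
    m<R = subst (ℕ._≤ suc n ∸ j) (+-∸-assoc 1 i≤n) (ℕP.∸-monoʳ-≤ (suc n) j≤i)

module FillArray where
  open Lists
  open ReadingWord
  open RepresentedArrays
  open import Data.Nat as ℕ using (ℕ; zero; suc; _∸_; _≤_)
  open import Data.Nat.Properties using (m+n∸m≡n; m+[n∸m]≡n; m≤n⇒m≤1+n; +-comm; +-assoc; +-suc; +-cancelˡ-≡)
  open import Data.Integer as ℤ using (ℤ; +_; -_; _+_; _-_; _*_)
  open import Data.Integer.Properties using (pos-+; i-j≤0⇒i≤j; i≤j⇒i-j≤0; drop‿+≤+)
  open import Data.Integer.Tactic.RingSolver
  open import Data.Vec using (Vec)
  open import Relation.Binary.PropositionalEquality

  fill : ∀ {n} → Vec ℕ n → Tableau n → ℕ → ℕ → ℤ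
  fill μ L m R = + (at μ R ℕ.+ countLe m (rowAt L R))

  φ-represents-fill : ∀ {n} (μ : Vec ℕ n) (L : Tableau n) → Represents n (φ μ L) (fill μ L)
  φ-represents-fill μ L = represents (φ-entry {μ = μ} {L})
    where
    φ-entry : ∀ {n} {μ : Vec ℕ n} {L k m h R} → k ℕ.+ m ≡ n → h ℕ.+ R ≡ suc n → h ≤ k → φ μ L k h ≡ - fill μ L m R
    φ-entry {μ = μ} {L} {k} {m} {h} {R} refl eh h≤k =
      cong₂ (λ a b → - (+ (at μ b ℕ.+ countLe a (rowAt L b)))) (m+n∸m≡n k m)
            (trans (cong (ℕ._+ (suc k ∸ h)) (m+n∸m≡n k m)) column)
      where
      column : m ℕ.+ (suc k ∸ h) ≡ R
      column = +-cancelˡ-≡ h _ _ (begin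
        h ℕ.+ (m ℕ.+ (suc k ∸ h)) ≡⟨ sym (+-assoc h m _) ⟩
        h ℕ.+ m ℕ.+ (suc k ∸ h)   ≡⟨ cong (ℕ._+ (suc k ∸ h)) (+-comm h m) ⟩
        m ℕ.+ h ℕ.+ (suc k ∸ h)   ≡⟨ +-assoc m h _ ⟩
        m ℕ.+ (h ℕ.+ (suc k ∸ h)) ≡⟨ cong (m ℕ.+_) (m+[n∸m]≡n (m≤n⇒m≤1+n h≤k)) ⟩
        m ℕ.+ suc k               ≡⟨ +-suc m k ⟩
        suc (m ℕ.+ k)             ≡⟨ cong suc (+-comm m k) ⟩
        suc (k ℕ.+ m)             ≡⟨ sym eh ⟩
        h ℕ.+ R                   ∎)
        where open ≡-Reasoning

  fill-suc : ∀ {n} (μ : Vec ℕ n) L m R → fill μ L (suc m) R ≡ fill μ L m R + + count (suc m) (rowAt L R)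
  fill-suc μ L m R = trans (cong (λ z → + (at μ R ℕ.+ z)) (countLe-suc m (rowAt L R)))
    (trans (cong +_ (sym (+-assoc (at μ R) (countLe m (rowAt L R)) (count (suc m) (rowAt L R)))))
           (pos-+ (at μ R ℕ.+ countLe m (rowAt L R)) (count (suc m) (rowAt L R))))

  sum-fill-suc : ∀ {n} (μ : Vec ℕ n) L m k → sumTo k (fill μ L (suc m)) ≡ sumTo k (fill μ L m) + + countRows L (suc m) k
  sum-fill-suc μ L m k =
    trans (sumTo-cong k _ _ (λ R _ _ → fill-suc μ L m R))
    (trans (sumTo-+ k (fill μ L m) (λ R → + count (suc m) (rowAt L R)))
           (cong (λ z → sumTo k (fill μ L m) + z) (sum-count k)))
    where
    sum-count : ∀ k → sumTo k (λ R → + count (suc m) (rowAt L R)) ≡ + countRows L (suc m) k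
    sum-count zero = refl
    sum-count (suc k) = trans (cong (_+ + count (suc m) (rowAt L (suc k))) (sum-count k))
      (trans (sym (pos-+ (countRows L (suc m) k) _))
             (cong +_ (trans (+-comm (countRows L (suc m) k) _) (sym (countRows-suc L (suc m) k)))))

  weight-of-fill : ∀ {n} (μ : Vec ℕ n) L m Λ →
    fill μ L m (suc m) + + countRows L (suc m) (suc m) ≡ Λ →
    - sumBetween (fill μ L m) m n + sumBetween (fill μ L (suc m)) (suc m) n ≡ - Λ + + countRows L (suc m) n
  weight-of-fill {n} μ L m Λ refl =
    trans (cong₂ (λ a b → - sumBetween (fill μ L m) m n + (a - b)) (sum-fill-suc μ L m n) (sum-fill-suc μ L m (suc m)))
          (telescope (sumTo n (fill μ L m)) (sumTo m (fill μ L m)) (fill μ L m (suc m))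
                     (+ countRows L (suc m) n) (+ countRows L (suc m) (suc m)))
    where
    telescope : ∀ Sn Sm z Cn Cs → - (Sn - Sm) + ((Sn + Cn) - ((Sm + z) + Cs)) ≡ - (z + Cs) + Cn
    telescope = solve-∀

  exponent-of-fill : ∀ {n} (μ : Vec ℕ n) L m r →
    exponentExpr n (fill μ L) m r
    ≡ (+ countRows L (suc m) n - + countRows L (suc m) r + + count (suc m) (rowAt L r))
      - (+ countRows L (suc (suc m)) n - + countRows L (suc (suc m)) r)
  exponent-of-fill {n} μ L m r = begin
    exponentExpr n (fill μ L) m r
      ≡⟨ cong₂ _+_ (cong₂ (λ a b → - S₀ + (+ 2) * a + - b) (unfold n r) (unfold₂ n r)) (cong (λ z → - fill μ L m r - - z) (fill-suc μ L m r)) ⟩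
    (- S₀ + (+ 2) * ((Sn + C₁ n) - (Sr + C₁ r)) + - ((Sn + C₁ n + C₂ n) - (Sr + C₁ r + C₂ r)))
      + (- fill μ L m r - - (fill μ L m r + + count (suc m) (rowAt L r)))
      ≡⟨ second-difference Sn Sr (C₁ n) (C₁ r) (C₂ n) (C₂ r) (fill μ L m r) (+ count (suc m) (rowAt L r)) ⟩
    (C₁ n - C₁ r + + count (suc m) (rowAt L r)) - (C₂ n - C₂ r) ∎
    where
    open ≡-Reasoning
    Sn = sumTo n (fill μ L m)
    Sr = sumTo r (fill μ L m)
    S₀ = sumBetween (fill μ L m) r n
    C₁ C₂ : ℕ → ℤ
    C₁ k = + countRows L (suc m) k
    C₂ k = + countRows L (suc (suc m)) k
    unfold : ∀ a b → sumBetween (fill μ L (suc m)) b a ≡ (sumTo a (fill μ L m) + C₁ a) - (sumTo b (fill μ L m) + C₁ b)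
    unfold a b = cong₂ _-_ (sum-fill-suc μ L m a) (sum-fill-suc μ L m b)
    unfold₂ : ∀ a b → sumBetween (fill μ L (suc (suc m))) b a ≡ (sumTo a (fill μ L m) + C₁ a + C₂ a) - (sumTo b (fill μ L m) + C₁ b + C₂ b)
    unfold₂ a b = cong₂ _-_ (trans (sum-fill-suc μ L (suc m) a) (cong (_+ C₂ a) (sum-fill-suc μ L m a)))
                            (trans (sum-fill-suc μ L (suc m) b) (cong (_+ C₂ b) (sum-fill-suc μ L m b)))
    second-difference : ∀ Sn Sr C1n C1r C2n C2r z c →
      (- (Sn - Sr) + (+ 2) * ((Sn + C1n) - (Sr + C1r)) + - ((Sn + C1n + C2n) - (Sr + C1r + C2r)))
        + (- z - - (z + c))
      ≡ (C1n - C1r + c) - (C2n - C2r)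
    second-difference = solve-∀

  -- The exponent bound on the expression above is the counting inequality
  -- F + c ≤ B, where A = #a, D = #(a+1) in L, B = #a, F = #(a+1) in rows ≤ r,
  -- and c = #a in row r.
  private
    bound-gap : ∀ A B c D F → ((+ A - + B + + c) - (+ D - + F)) - (+ A - + D) ≡ (+ F + + c) - + B
    bound-gap A B c D F = gap (+ A) (+ B) (+ c) (+ D) (+ F)
      where
      gap : ∀ a b c d f → ((a - b + c) - (d - f)) - (a - d) ≡ (f + c) - b
      gap = solve-∀

  count-inequality⇒exponent-bound : ∀ A B c D F → F ℕ.+ c ≤ B → (+ A - + B + + c) - (+ D - + F) ℤ.≤ + A - + D
  count-inequality⇒exponent-bound A B c D F le = i-j≤0⇒i≤j (subst (ℤ._≤ + 0) (sym (bound-gap A B c D F))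
    (i≤j⇒i-j≤0 (subst (ℤ._≤ + B) (pos-+ F c) (ℤ.+≤+ le))))

  exponent-bound⇒count-inequality : ∀ A B c D F → (+ A - + B + + c) - (+ D - + F) ℤ.≤ + A - + D → F ℕ.+ c ≤ B
  exponent-bound⇒count-inequality A B c D F le = drop‿+≤+ (subst (ℤ._≤ + B) (sym (pos-+ F c))
    (i-j≤0⇒i≤j (subst (ℤ._≤ + 0) (bound-gap A B c D F) (i≤j⇒i-j≤0 le))))

module GZDictionary {n : ℕ} (lam μ : Vec ℕ n) (L : Tableau n) where
  open Lists
  open Indexing
  open ReadingWord
  open IndexArithmetic
  open RepresentedArrays
  open FillArray
  open import Data.Nat as ℕ using (ℕ; suc; _∸_; _≤_; z≤n; s≤s)
  open import Data.Nat.Properties using (m≤n⇒m≤1+n; +-identityʳ; ≤-trans; ≤-refl)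
  open import Data.Integer using (+_; -_; _+_; _-_)
  open import Data.List using (length)
  open import Data.List.Relation.Unary.All as All using (All)
  open import Relation.Binary.PropositionalEquality

  -- Row m+1 holds μ, then its letters ≤ m, then its letters m+1, and no
  -- letter m+1 occurs higher up.
  RowFilled : ℕ → Set
  RowFilled m = fill μ L m (suc m) + + countRows L (suc m) (suc m) ≡ + at lam (suc m)

  row-filled : ∀ m → (∀ R → 1 ≤ R → R ≤ suc m → All (_≤ R) (rowAt L R)) →
               at μ (suc m) ℕ.+ length (rowAt L (suc m)) ≡ at lam (suc m) → RowFilled m
  row-filled m bounded ends = begin
    fill μ L m (suc m) + + countRows L (suc m) (suc m)
      ≡⟨ cong (λ z → fill μ L m (suc m) + + z) only-in-own-row ⟩
    fill μ L m (suc m) + + count (suc m) (rowAt L (suc m))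
      ≡⟨ sym (fill-suc μ L m (suc m)) ⟩
    fill μ L (suc m) (suc m)
      ≡⟨ cong (λ z → + (at μ (suc m) ℕ.+ z)) (countLe-all _ (bounded (suc m) (s≤s z≤n) ≤-refl)) ⟩
    + (at μ (suc m) ℕ.+ length (rowAt L (suc m)))
      ≡⟨ cong +_ ends ⟩
    + at lam (suc m) ∎
    where
    open ≡-Reasoning
    only-in-own-row : countRows L (suc m) (suc m) ≡ count (suc m) (rowAt L (suc m))
    only-in-own-row = trans (countRows-suc L (suc m) m)
      (trans (cong (count (suc m) (rowAt L (suc m)) ℕ.+_)
               (countRows-absent L (suc m) m (λ R p q → All.map (λ le → s≤s (≤-trans le q)) (bounded R p (m≤n⇒m≤1+n q)))))
             (+-identityʳ _))

  weight-of-φ : ∀ i m → suc i ℕ.+ m ≡ n → RowFilled m →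
                weightAt (φ μ L) (suc i) ≡ - + at lam (suc m) + + countRows L (suc m) n
  weight-of-φ i m e filled =
    trans (weight-via-represent (φ-represents-fill μ L) i m e) (weight-of-fill μ L m _ filled)

  exponent-of-φ : ∀ i j m → suc i ℕ.+ suc m ≡ n → j ≤ i →
    ε (φ μ L) (suc i) (suc j)
    ≡ (+ countRows L (suc m) n - + countRows L (suc m) (n ∸ j) + + count (suc m) (rowAt L (n ∸ j)))
      - (+ countRows L (suc (suc m)) n - + countRows L (suc (suc m)) (n ∸ j))
  exponent-of-φ i j m e j≤i =
    trans (exponent-via-represent (φ-represents-fill μ L) i j m e j≤i) (exponent-of-fill μ L m (n ∸ j))

module DualTargets {n : ℕ} (lam ν : Vec ℕ n) where
  open Indexing
  open import Data.Nat as ℕ using (ℕ; suc; _∸_; _≤_; z≤n; s≤s)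
  open import Data.Nat.Properties as ℕP using (m+n∸m≡n; +-suc; ≤-trans; m≤m+n)
  open import Data.Integer as ℤ using (ℤ; +_; -_; _+_; _-_)
  open import Data.Integer.Tactic.RingSolver
  open import Relation.Binary.PropositionalEquality

  weight-target : ∀ i m → suc i ℕ.+ m ≡ n → atℤ (dual lam -ᵥ dual ν) (suc i) ≡ - + at lam (suc m) + + at ν (suc m)
  weight-target i m e =
    trans (atℤ-zip ℤ._-_ (dual lam) (dual ν) (suc i) (s≤s z≤n) si≤n)
    (trans (cong₂ _-_ (trans (at-dual lam (suc i) (s≤s z≤n) si≤n) (cong (λ z → - + at lam z) n∸i))
                      (trans (at-dual ν (suc i) (s≤s z≤n) si≤n) (cong (λ z → - + at ν z) n∸i)))
           (minus-neg (+ at lam (suc m)) (+ at ν (suc m))))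
    where
    si≤n : suc i ≤ n
    si≤n = subst (suc i ≤_) e (m≤m+n (suc i) m)
    n∸i : n ∸ i ≡ suc m
    n∸i = trans (cong (_∸ i) (sym (trans (+-suc i m) e))) (m+n∸m≡n i (suc m))
    minus-neg : ∀ a b → - a - - b ≡ - a + b
    minus-neg = solve-∀

  exponent-target : ∀ i m → suc i ℕ.+ suc m ≡ n →
    atℤ (dual ν) (suc i) - atℤ (dual ν) (suc (suc i)) ≡ + at ν (suc m) - + at ν (suc (suc m))
  exponent-target i m e =
    trans (cong₂ _-_ (trans (at-dual ν (suc i) (s≤s z≤n) (≤-trans (ℕP.n≤1+n (suc i)) ssi≤n)) (cong (λ z → - + at ν z) n∸i))
                     (trans (at-dual ν (suc (suc i)) (s≤s z≤n) ssi≤n) (cong (λ z → - + at ν z) n∸si)))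
          (swap (+ at ν (suc m)) (+ at ν (suc (suc m))))
    where
    e₂ : suc (suc i) ℕ.+ m ≡ n
    e₂ = trans (sym (+-suc (suc i) m)) e
    ssi≤n : suc (suc i) ≤ n
    ssi≤n = subst (suc (suc i) ≤_) e₂ (m≤m+n (suc (suc i)) m)
    n∸i : n ∸ i ≡ suc (suc m)
    n∸i = trans (cong (_∸ i) (sym (trans (+-suc i (suc m)) e))) (m+n∸m≡n i (suc (suc m)))
    n∸si : n ∸ suc i ≡ suc m
    n∸si = trans (cong (_∸ suc i) (sym e)) (m+n∸m≡n (suc i) (suc m))
    swap : ∀ a b → - b - - a ≡ a - b
    swap = solve-∀

module Forward {n : ℕ} (lam μ ν : Vec ℕ n) (dl : Dominant lam) (dm : Dominant μ)
               (μ≤λ : ∀ i → lookup μ i ≤ lookup lam i) (L : Tableau n) (lr : IsLR lam μ ν L) where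
  open IsLR lr
  open Lists
  open Indexing
  open ReadingWord
  open IndexArithmetic
  open RepresentedArrays
  open FillArray
  open GZDictionary lam μ L
  open DualTargets lam ν
  open import Data.Nat as ℕ using (ℕ; zero; suc; _∸_; _≤_; _<_; z≤n; s≤s; _≤?_)
  open import Data.Nat.Properties
  open import Data.Integer as ℤ using (ℤ; +_; -_)
  open import Data.Fin using (toℕ)
  open import Data.List using (length; drop; _++_)
  open import Data.List.Relation.Unary.All as All using (All)
  open import Data.List.Relation.Unary.All.Properties using (++⁻ˡ; ++⁻ʳ)
  open import Data.Maybe using (just)
  open import Relation.Binary.PropositionalEquality
  open import Relation.Nullary
  open import Data.Product
  open import Data.Empty

  row-end : ∀ R → 1 ≤ R → R ≤ n → at μ R ℕ.+ length (rowAt L R) ≡ at lam R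
  row-end R p q with toFin R p q
  ... | i , refl =
    trans (cong₂ ℕ._+_ (at-lookup μ i) (trans (cong length (rowAt-lookup L i)) (shape i)))
          (trans (m+[n∸m]≡n (μ≤λ i)) (sym (at-lookup lam i)))

  entry-nth : ∀ i k → entry μ L i (suc (lookup μ i ℕ.+ k)) ≡ nth (lookup L i) k
  entry-nth i k = trans (entry-eq μ L i _ (s≤s (m≤m+n _ k))) (cong (nth (lookup L i)) (m+n∸m≡n (lookup μ i) k))

  row-sorted : ∀ R → 1 ≤ R → R ≤ n → Sorted (rowAt L R)
  row-sorted R p q with toFin R p q
  ... | i , refl = subst Sorted (sym (rowAt-lookup L i))
    (sorted-from-positions (lookup L i) (λ k k' x y lt e1 e2 →
      rowWeak i _ _ x y (s≤s (+-monoʳ-< (lookup μ i) lt)) (trans (entry-nth i k) e1) (trans (entry-nth i k') e2)))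

  -- Entries of rows R < R' in the same column (μ_R + k + 1 = μ_R' + k' + 1) increase.
  column-strict : ∀ R R' → 1 ≤ R → R < R' → R' ≤ n → ∀ k k' x y → at μ R ℕ.+ k ≡ at μ R' ℕ.+ k' →
                  nth (rowAt L R) k ≡ just x → nth (rowAt L R') k' ≡ just y → x < y
  column-strict R R' p lt q k k' x y same e1 e2 with toFin R p (≤-trans (<⇒≤ lt) q) | toFin R' (≤-trans p (<⇒≤ lt)) q
  ... | i , refl | i' , refl =
    colStrict i i' (≤-pred lt) (suc (lookup μ i ℕ.+ k)) x y
      (trans (entry-nth i k) (trans (cong (λ z → nth z k) (sym (rowAt-lookup L i))) e1))
      (trans (cong (λ z → entry μ L i' (suc z))
                   (trans (cong (ℕ._+ k) (sym (at-lookup μ i))) (trans same (cong (ℕ._+ k') (at-lookup μ i')))))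
        (trans (entry-nth i' k') (trans (cong (λ z → nth z k') (sym (rowAt-lookup L i'))) e2)))

  row-range : ∀ R → 1 ≤ R → R ≤ n → All (λ x → 1 ≤ x × x ≤ n) (rowAt L R)
  row-range R p q with rowsUp-split L n R p q
  ... | pre , e = ++⁻ˡ (rowAt L R) (++⁻ʳ pre (subst (All _) (trans (readingWord≡rowsUp L) e) entryRange))

  content-at : ∀ v → 1 ≤ v → v ≤ n → countRows L v n ≡ at ν v
  content-at v p q with toFin v p q
  ... | i , refl = trans (cong (count (suc (toℕ i))) (sym (readingWord≡rowsUp L))) (trans (content i) (sym (at-lookup ν i)))

  yamanouchi-from-box : ∀ r t → 1 ≤ r → r ≤ n → t ≤ length (rowAt L r) → ∀ a → 1 ≤ a →
    count (suc a) (drop t (rowAt L r) ++ rowsUp L (r ∸ 1)) ≤ count a (drop t (rowAt L r) ++ rowsUp L (r ∸ 1))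
  yamanouchi-from-box r t p q t≤ a pa with suffix-from-box L n r t p q t≤
  ... | s , e = subst (λ w → count (suc a) w ≤ count a w) (trans (cong (drop s) (readingWord≡rowsUp L)) e) (yamanouchi s a pa)

  -- Row R only has letters ≤ R: a letter a+1 > R read first in its suffix
  -- (no a occurs after it in row R, nor in the rows above, which have letters
  -- < R by induction) would break the Yamanouchi condition.
  row-bounded : ∀ R → 1 ≤ R → R ≤ n → All (_≤ R) (rowAt L R)
  row-bounded R p q = upTo n ≤-refl R p q
    where
    upTo : ∀ K → K ≤ n → ∀ R → 1 ≤ R → R ≤ K → All (_≤ R) (rowAt L R)
    upTo zero _ (suc R) (s≤s _) ()
    upTo (suc K) K<n R p q with R ≟ suc K
    ... | no ne = upTo K (≤-trans (n≤1+n K) K<n) R p (≤-pred (≤∧≢⇒< q ne))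
    ... | yes refl = All-nth (rowAt L (suc K)) bound
      where
      above : ∀ R → 1 ≤ R → R ≤ K → All (_≤ R) (rowAt L R)
      above = upTo K (≤-trans (n≤1+n K) K<n)
      bound : ∀ k x → nth (rowAt L (suc K)) k ≡ just x → x ≤ suc K
      bound k x e with x ≤? suc K
      ... | yes le = le
      ... | no gt with x | ≰⇒> gt
      ...   | suc a | s≤s K<a with drop-head (row-sorted (suc K) p K<n) k (suc a) e
      ...     | rest , de , al = ⊥-elim (<⇒≱ (s≤s z≤n) (subst₂ _≤_ countSucA countA
                  (yamanouchi-from-box (suc K) k p K<n (<⇒≤ (nth-length (rowAt L (suc K)) k (suc a) e)) a (≤-trans (s≤s z≤n) K<a))))
        where
        countSucA : count (suc a) (drop k (rowAt L (suc K)) ++ rowsUp L K) ≡ suc (count (suc a) (rest ++ rowsUp L K))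
        countSucA = trans (cong (λ z → count (suc a) (z ++ rowsUp L K)) de) (count-hit (rest ++ rowsUp L K) refl)
        countA : count a (drop k (rowAt L (suc K)) ++ rowsUp L K) ≡ 0
        countA = trans (cong (λ z → count a (z ++ rowsUp L K)) de)
          (trans (count-miss (rest ++ rowsUp L K) (λ ee → 1+n≢n ee))
          (trans (count-++ a rest (rowsUp L K))
            (cong₂ ℕ._+_ (count-none rest (All.map (λ le ee → <-irrefl (sym ee) (<-≤-trans (n<1+n a) le)) al))
                         (countRows-absent L a K (λ R' a' b' → All.map (λ le → <-≤-trans (s≤s le) (≤-trans (s≤s b') K<a)) (above R' a' b'))))))

  -- Yamanouchi for the suffix starting at the first letter > a of row r:
  -- #(a+1) in rows ≤ r plus #a in row r is at most #a in rows ≤ r.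
  yamanouchi-at-row : ∀ r → 1 ≤ r → r ≤ n → ∀ a → 1 ≤ a → countRows L (suc a) r ℕ.+ count a (rowAt L r) ≤ countRows L a r
  yamanouchi-at-row (suc r) _ q a pa with split a (row-sorted (suc r) (s≤s z≤n) q)
  ... | sp@(mkSplit ys zs eq ys≤a zs>a) =
    subst₂ _≤_ (sym (cong (ℕ._+ c) (countRows-suc L (suc a) r))) (sym (countRows-suc L a r))
      (≤-trans (≤-reflexive (+-comm _ c)) (+-monoʳ-≤ c key))
    where
    row = rowAt L (suc r)
    c = count a row
    above = rowsUp L r
    rest : drop (countLe a row) row ≡ zs
    rest = trans (cong₂ drop (split-countLe a sp) eq) (drop-++ ys zs)
    sucA-in-row : count (suc a) row ≡ count (suc a) zs
    sucA-in-row = trans (cong (count (suc a)) eq) (trans (count-++ (suc a) ys zs)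
      (cong (ℕ._+ count (suc a) zs) (count-none ys (All.map (λ le e → 1+n≰n (subst (_≤ a) e le)) ys≤a))))
    no-a-after : count a zs ≡ 0
    no-a-after = count-none zs (All.map (λ lt e → <-irrefl (sym e) lt) zs>a)
    key : count (suc a) row ℕ.+ countRows L (suc a) r ≤ countRows L a r
    key = subst₂ _≤_
      (trans (cong (λ w → count (suc a) (w ++ above)) rest) (trans (count-++ (suc a) zs above) (cong (ℕ._+ countRows L (suc a) r) (sym sucA-in-row))))
      (trans (cong (λ w → count a (w ++ above)) rest) (trans (count-++ a zs above) (cong (ℕ._+ countRows L a r) no-a-after)))
      (yamanouchi-from-box (suc r) (countLe a row) (s≤s z≤n) q (countLe≤length a row) a pa)

  fill-row0 : ∀ R → 1 ≤ R → R ≤ n → fill μ L 0 R ≡ + at μ R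
  fill-row0 R p q = trans (cong (λ z → + (at μ R ℕ.+ z)) (countLe-none _ (All.map proj₁ (row-range R p q))))
                         (cong +_ (+-identityʳ (at μ R)))

  fill-grows : RowsGrow n (fill μ L)
  fill-grows m R _ _ = ℤ.+≤+ (+-monoʳ-≤ (at μ R) (countLe-mono (rowAt L R) (n≤1+n m)))

  -- If the entries ≤ m of row R ended left of those ≤ m+1 of row R+1, the box
  -- below the first entry x > m of row R would hold an entry y ≤ m+1 ≤ x.
  fill-shrinks : DiagonalsShrink n (fill μ L)
  fill-shrinks m R m<R sR≤n = ℤ.+≤+ (diagonal m R m<R sR≤n)
    where
    diagonal : ∀ m r → suc m ≤ r → suc r ≤ n →
               at μ (suc r) ℕ.+ countLe (suc m) (rowAt L (suc r)) ≤ at μ r ℕ.+ countLe m (rowAt L r)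
    diagonal m r m<r sr≤n with (at μ (suc r) ℕ.+ countLe (suc m) (rowAt L (suc r))) ≤? (at μ r ℕ.+ countLe m (rowAt L r))
    ... | yes le = le
    ... | no gt = ⊥-elim (<⇒≱ x<y (≤-trans y≤sm sm≤x))
      where
      below = rowAt L (suc r)
      here = rowAt L r
      C = countLe (suc m) below
      C' = countLe m here
      p = at μ r ℕ.+ C'
      p< : p < at μ (suc r) ℕ.+ C
      p< = ≰⇒> gt
      1≤r : 1 ≤ r
      1≤r = ≤-trans (s≤s z≤n) m<r
      r≤n : r ≤ n
      r≤n = ≤-trans (n≤1+n r) sr≤n
      μ≤p : at μ (suc r) ≤ p
      μ≤p = ≤-trans (dm r 1≤r sr≤n) (m≤m+n _ _)
      k = p ∸ at μ (suc r)
      k<C : k < C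
      k<C = +-cancelˡ-< (at μ (suc r)) k C (subst (_< at μ (suc r) ℕ.+ C) (sym (m+[n∸m]≡n μ≤p)) p<)
      yk : Σ ℕ λ y → nth below k ≡ just y
      yk = nth-total below k (<-≤-trans k<C (countLe≤length (suc m) below))
      y = proj₁ yk
      y≤sm : y ≤ suc m
      y≤sm = sorted-nth-le (suc m) (row-sorted (suc r) (s≤s z≤n) sr≤n) k y k<C (proj₂ yk)
      p<λ : p < at lam r
      p<λ = <-≤-trans p< (≤-trans (subst (at μ (suc r) ℕ.+ C ≤_) (row-end (suc r) (s≤s z≤n) sr≤n)
                                          (+-monoʳ-≤ (at μ (suc r)) (countLe≤length (suc m) below)))
                                 (dl r 1≤r sr≤n))
      C'<len : C' < length here
      C'<len = +-cancelˡ-< (at μ r) C' (length here) (subst (p <_) (sym (row-end r 1≤r r≤n)) p<λ)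
      xk : Σ ℕ λ x → nth here C' ≡ just x
      xk = nth-total here C' C'<len
      x = proj₁ xk
      sm≤x : suc m ≤ x
      sm≤x = sorted-nth-gt m (row-sorted r 1≤r r≤n) C' x ≤-refl (proj₂ xk)
      x<y : x < y
      x<y = column-strict r (suc r) 1≤r ≤-refl sr≤n C' k x y (sym (m+[n∸m]≡n μ≤p)) (proj₂ xk) (proj₂ yk)

  row-filled-L : ∀ m → suc m ≤ n → RowFilled m
  row-filled-L m sm≤n = row-filled m (λ R p q → row-bounded R p (≤-trans q sm≤n)) (row-end (suc m) (s≤s z≤n) sm≤n)

  φ-weight : ∀ i → 1 ≤ i → i ≤ n → weightAt (φ μ L) i ≡ atℤ (dual lam -ᵥ dual ν) i
  φ-weight (suc i) _ si≤n =
    trans (weight-of-φ i m e (row-filled-L m sm≤n))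
    (trans (cong (λ z → - + at lam (suc m) ℤ.+ + z) (content-at (suc m) (s≤s z≤n) sm≤n))
           (sym (weight-target i m e)))
    where
    m = n ∸ suc i
    e : suc i ℕ.+ m ≡ n
    e = m+[n∸m]≡n si≤n
    sm≤n : suc m ≤ n
    sm≤n = summand≤ (trans (+-suc i m) e)

  φ-exponent : ∀ i j → 1 ≤ j → j ≤ i → i < n → ε (φ μ L) i j ℤ.≤ atℤ (dual ν) i ℤ.- atℤ (dual ν) (suc i)
  φ-exponent (suc i) (suc j) _ (s≤s j≤i) i<n =
    subst₂ ℤ._≤_ (sym (exponent-of-φ i j m e j≤i)) (sym bound)
      (count-inequality⇒exponent-bound _ _ _ _ _
        (yamanouchi-at-row (n ∸ j) (m<n⇒0<n∸m j<n) (m∸n≤m n j) (suc m) (s≤s z≤n)))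
    where
    m = n ∸ suc (suc i)
    e : suc i ℕ.+ suc m ≡ n
    e = trans (+-suc (suc i) m) (m+[n∸m]≡n i<n)
    j<n : j < n
    j<n = ≤-trans (s≤s (≤-trans j≤i (n≤1+n i))) i<n
    ssm≤n : suc (suc m) ≤ n
    ssm≤n = summand≤ (trans (+-suc i (suc m)) e)
    bound : atℤ (dual ν) (suc i) ℤ.- atℤ (dual ν) (suc (suc i)) ≡ + countRows L (suc m) n ℤ.- + countRows L (suc (suc m)) n
    bound = trans (exponent-target i m e)
      (sym (cong₂ (λ a b → + a ℤ.- + b) (content-at (suc m) (s≤s z≤n) (≤-trans (n≤1+n _) ssm≤n))
                                        (content-at (suc (suc m)) (s≤s z≤n) ssm≤n)))

  φ-in-GZ : InGZ (dual μ) (dual lam -ᵥ dual ν) (dual ν) (φ μ L)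
  φ-in-GZ = record
    { gt = gt-from-represent (φ-represents-fill μ L) fill-grows fill-shrinks
    ; type = type-from-represent μ (φ-represents-fill μ L) fill-row0
    ; weight = φ-weight
    ; exponent = φ-exponent
    }

-- Rows of an LR
-- tableau are sorted, hence determined by their cumulative counts; φ records
-- the counts of letters below the row index, and the others equal the row length.
module Injectivity where
  open Lists
  open IndexArithmetic
  open RepresentedArrays
  open FillArray
  open import Data.Nat using (ℕ; suc; _≤_; z≤n; s≤s; _≤?_)
  open import Data.Nat.Properties using (≤-trans; ≰⇒>; +-cancelˡ-≡)
  open import Data.Integer.Properties using (+-injective)
  open import Data.Vec as Vec using (Vec; lookup)
  open import Data.List.Relation.Unary.All as All using ()
  open import Relation.Binary.PropositionalEquality
  open import Relation.Nullary

  tableau-ext : ∀ {n} (L₁ L₂ : Tableau n) → (∀ R → 1 ≤ R → R ≤ n → rowAt L₁ R ≡ rowAt L₂ R) → L₁ ≡ L₂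
  tableau-ext Vec.[] Vec.[] f = refl
  tableau-ext (x Vec.∷ xs) (y Vec.∷ ys) f =
    cong₂ Vec._∷_ (f 1 (s≤s z≤n) (s≤s z≤n))
      (tableau-ext xs ys (λ { (suc R) p q → f (suc (suc R)) (s≤s z≤n) (s≤s q) }))

  injective : ∀ {n} (lam μ ν : Vec ℕ n) → Dominant lam → Dominant μ → (∀ i → lookup μ i ≤ lookup lam i) →
    (L₁ L₂ : Tableau n) → IsLR lam μ ν L₁ → IsLR lam μ ν L₂ → φ μ L₁ ≈[ n ] φ μ L₂ → L₁ ≡ L₂
  injective {n} lam μ ν dl dm μ≤λ L₁ L₂ lr₁ lr₂ φ≈ = tableau-ext L₁ L₂ same-row
    where
    module F₁ = Forward lam μ ν dl dm μ≤λ L₁ lr₁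
    module F₂ = Forward lam μ ν dl dm μ≤λ L₂ lr₂
    same-row : ∀ R → 1 ≤ R → R ≤ n → rowAt L₁ R ≡ rowAt L₂ R
    same-row R p q = sorted-by-countLe (F₁.row-sorted R p q) (F₂.row-sorted R p q) same-counts
      where
      same-counts : ∀ v → countLe v (rowAt L₁ R) ≡ countLe v (rowAt L₂ R)
      same-counts v with R ≤? v
      ... | yes R≤v = trans (countLe-all _ (All.map (λ le → ≤-trans le R≤v) (F₁.row-bounded R p q)))
                     (trans (+-cancelˡ-≡ (at μ R) _ _ (trans (F₁.row-end R p q) (sym (F₂.row-end R p q))))
                            (sym (countLe-all _ (All.map (λ le → ≤-trans le R≤v) (F₂.row-bounded R p q)))))
      ... | no R≰v = +-cancelˡ-≡ (at μ R) _ _ (+-injective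
                       (agree-from-≈ (φ-represents-fill μ L₁) (φ-represents-fill μ L₂) φ≈ v R (≰⇒> R≰v) q))

-- Read T through the array F = fillOf it represents.  The type and
-- interlacing conditions say F 0 R = μ_R, rows of F grow and diagonals
-- shrink; the weight and the diagonal exponents give F (R−1) R ≤ λ_R.  Row R
-- of the tableau is the sorted row with cumulative counts F m R − μ_R (m < R),
-- so that φ(L) = T.  Content and Yamanouchi then follow from the weight and
-- exponent conditions of T = φ(L) through `GZDictionary`, and column
-- strictness from the shrinking diagonals.
module Backward {n : ℕ} (lam μ ν : Vec ℕ n) (dl : Dominant lam) (dm : Dominant μ)
                (μ≤λ : ∀ i → lookup μ i ≤ lookup lam i) (T : TArray)
                (gz : InGZ (dual μ) (dual lam -ᵥ dual ν) (dual ν) T) where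
  open InGZ gz
  open Lists
  open Indexing
  open ReadingWord
  open IndexArithmetic
  open RepresentedArrays
  open FillArray
  open DualTargets lam ν
  open import Data.Nat as ℕ using (ℕ; zero; suc; _∸_; _≤_; _<_; z≤n; s≤s; _≤?_; _<?_; _⊓_)
  open import Data.Nat.Properties
  open import Data.Integer as ℤ using (ℤ; +_; -_; ∣_∣; _-_)
  open import Data.Integer.Properties as ℤP using (neg-involutive; 0≤i⇒+∣i∣≡i; 0≤i-j⇒j≤i; +-injective; drop‿+≤+; i-j≤0⇒i≤j; i≤j⇒i-j≤0)
  open import Data.Integer.Tactic.RingSolver
  open import Data.Fin using (Fin; toℕ)
  open import Data.Fin.Properties using (toℕ<n)
  open import Data.Vec as Vec using (Vec; lookup)
  open import Data.Vec.Properties using (lookup∘tabulate)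
  open import Data.List using (List; []; length; drop)
  open import Data.List.Relation.Unary.All as All using (All; [])
  open import Data.List.Relation.Unary.All.Properties using (++⁺)
  open import Data.Maybe using (just)
  open import Relation.Binary.PropositionalEquality
  open import Relation.Nullary
  open import Data.Product
  open import Data.Sum using (_⊎_; inj₁; inj₂)
  open import Data.Empty

  fillOf : ℕ → ℕ → ℤ
  fillOf m R = - T (n ∸ m) (suc n ∸ R)

  T-represents : Represents n T fillOf
  T-represents = represents λ {k} {m} {h} {R} ek eh _ →
    sym (trans (neg-involutive _) (cong₂ T (trans (cong (_∸ m) (sym ek)) (m+n∸n≡m k m))
                                           (trans (cong (_∸ R) (sym eh)) (m+n∸n≡m h R))))

  fill-row0 : ∀ R → 1 ≤ R → R ≤ n → fillOf 0 R ≡ + at μ R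
  fill-row0 = represent-from-type μ T-represents type

  fill-grows : RowsGrow n fillOf
  fill-grows = proj₁ (represent-from-gt T-represents gt)

  fill-shrinks : DiagonalsShrink n fillOf
  fill-shrinks = proj₂ (represent-from-gt T-represents gt)

  fill-weight : ∀ m → suc m ≤ n → weightExpr n fillOf m ≡ - + at lam (suc m) ℤ.+ + at ν (suc m)
  fill-weight m sm≤n =
    trans (sym (weight-via-represent T-represents (n ∸ suc m) m e))
          (trans (weight (suc (n ∸ suc m)) (s≤s z≤n) (summand≤ (trans (+-comm m _) e))) (weight-target (n ∸ suc m) m e))
    where
    e : suc (n ∸ suc m) ℕ.+ m ≡ n
    e = complement-suc sm≤n

  -- room R = λ_R − F (R−1) R: the space left in row R for the letter R.
  room : ℕ → ℤ
  room R = + at lam R - fillOf (R ∸ 1) R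

  -- The exponent bound on the diagonal makes the room shrink downwards.
  room-step : ∀ m → suc (suc m) ≤ n → room (suc (suc m)) ℤ.≤ room (suc m)
  room-step m ssm≤n = i-j≤0⇒i≤j (subst (ℤ._≤ + 0)
      (regroup (+ at lam (suc m)) (+ at ν (suc m)) (+ at lam (suc (suc m))) (+ at ν (suc (suc m))) (fillOf m (suc m)) (fillOf (suc m) (suc (suc m))))
      (i≤j⇒i-j≤0 diagonal-bound))
    where
    i = n ∸ suc (suc m)
    e : suc i ℕ.+ suc m ≡ n
    e = complement-suc ssm≤n
    n∸i : n ∸ i ≡ suc (suc m)
    n∸i = trans (cong (_∸ i) (sym (trans (+-suc i (suc m)) e))) (m+n∸m≡n i (suc (suc m)))
    i<n : suc i < n
    i<n = summand≤ (trans (+-comm m (suc (suc i))) (trans (sym (+-suc (suc i) m)) e))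
    diagonal-bound : ((- + at lam (suc m) ℤ.+ + at ν (suc m)) - (- + at lam (suc (suc m)) ℤ.+ + at ν (suc (suc m))))
                       ℤ.+ (fillOf m (suc m) - fillOf (suc m) (suc (suc m)))
                     ℤ.≤ + at ν (suc m) - + at ν (suc (suc m))
    diagonal-bound = subst₂ ℤ._≤_
      (trans (exponent-via-represent T-represents i i m e ≤-refl)
      (trans (cong (exponentExpr n fillOf m) n∸i)
      (trans (exponent-on-diagonal n fillOf m)
             (cong₂ (λ a b → (a - b) ℤ.+ (fillOf m (suc m) - fillOf (suc m) (suc (suc m))))
                    (fill-weight m (≤-trans (n≤1+n _) ssm≤n)) (fill-weight (suc m) ssm≤n)))))
      (exponent-target i m e)
      (exponent (suc i) (suc i) (s≤s z≤n) ≤-refl i<n)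
    regroup : ∀ l₁ v₁ l₂ v₂ x y →
      (((- l₁ ℤ.+ v₁) - (- l₂ ℤ.+ v₂)) ℤ.+ (x - y)) - (v₁ - v₂) ≡ (l₂ - y) - (l₁ - x)
    regroup = solve-∀

  -- The weight of the last row: room n = ν_n.
  room-last : ∀ r → suc r ≡ n → room (suc r) ≡ + at ν (suc r)
  room-last r e = cancel (+ at lam (suc r)) (trans (sym (last-row (sumTo r (fillOf r)) (fillOf r (suc r)) (sumTo (suc r) (fillOf (suc r)))))
                        (trans (cong (λ z → weightExpr z fillOf r) e) (fill-weight r (≤-reflexive e))))
    where
    last-row : ∀ S x S' → - (S ℤ.+ x - S) ℤ.+ (S' - S') ≡ - x
    last-row = solve-∀
    cancel : ∀ l → - fillOf r (suc r) ≡ - l ℤ.+ + at ν (suc r) → l - fillOf r (suc r) ≡ + at ν (suc r)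
    cancel l eq = trans (cong (λ z → l ℤ.+ z) eq) (cancel-l l (+ at ν (suc r)))
      where
      cancel-l : ∀ a b → a ℤ.+ (- a ℤ.+ b) ≡ b
      cancel-l = solve-∀

  -- Hence room R ≥ room n = ν_n ≥ 0, i.e. the letters < R fit into row R.
  room-nonneg : ∀ d R → 1 ≤ R → R ℕ.+ d ≡ n → + 0 ℤ.≤ room R
  room-nonneg zero (suc r) _ e = subst (+ 0 ℤ.≤_) (sym (room-last r (trans (sym (+-identityʳ _)) e))) (ℤ.+≤+ z≤n)
  room-nonneg (suc d) (suc m) _ e =
    ℤP.≤-trans (room-nonneg d (suc (suc m)) (s≤s z≤n) (trans (sym (+-suc (suc m) d)) e))
               (room-step m (summand≤ (trans (+-comm d _) (trans (sym (+-suc (suc m) d)) e))))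

  fill-below-λ : ∀ R → 1 ≤ R → R ≤ n → fillOf (R ∸ 1) R ℤ.≤ + at lam R
  fill-below-λ R p q = 0≤i-j⇒j≤i (room-nonneg (n ∸ R) R p (m+[n∸m]≡n q))

  -- Rows of F start at μ and grow, so F m R − μ_R is a count.
  fill-above-μ : ∀ m R → m < R → R ≤ n → + at μ R ℤ.≤ fillOf m R
  fill-above-μ zero R p q = ℤP.≤-reflexive (sym (fill-row0 R p q))
  fill-above-μ (suc m) R p q = ℤP.≤-trans (fill-above-μ m R (≤-trans (n≤1+n _) p) q) (fill-grows m R p q)

  -- targetCount m R: the number of letters ≤ m that row R must receive.
  targetCount : ℕ → ℕ → ℕ
  targetCount m R = ∣ fillOf m R ∣ ∸ at μ R

  fillOf-form : ∀ m R → m < R → R ≤ n → fillOf m R ≡ + (at μ R ℕ.+ targetCount m R)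
  fillOf-form m R p q with 0≤i⇒+∣i∣≡i (ℤP.≤-trans (ℤ.+≤+ z≤n) (fill-above-μ m R p q))
  ... | e = trans (sym e) (cong +_ (sym (m+[n∸m]≡n (drop‿+≤+ (subst (+ at μ R ℤ.≤_) (sym e) (fill-above-μ m R p q))))))

  cumCount : ℕ → ℕ → ℕ
  cumCount R v with suc v ≤? R
  ... | yes _ = targetCount v R
  ... | no _ = at lam R ∸ at μ R

  cumCount-below : ∀ R v → suc v ≤ R → cumCount R v ≡ targetCount v R
  cumCount-below R v lt with suc v ≤? R
  ... | yes _ = refl
  ... | no ne = ⊥-elim (ne lt)

  cumCount-above : ∀ R v → R ≤ v → cumCount R v ≡ at lam R ∸ at μ R
  cumCount-above R v le with suc v ≤? R
  ... | yes lt = ⊥-elim (<⇒≱ lt le)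
  ... | no _ = refl

  targetCount-0 : ∀ R → 1 ≤ R → R ≤ n → targetCount 0 R ≡ 0
  targetCount-0 R p q = trans (cong (λ z → ∣ z ∣ ∸ at μ R) (fill-row0 R p q)) (n∸n≡0 (at μ R))

  cumCount-0 : ∀ R → 1 ≤ R → R ≤ n → cumCount R 0 ≡ 0
  cumCount-0 R p q = trans (cumCount-below R 0 p) (targetCount-0 R p q)

  cumCount-mono : ∀ R → 1 ≤ R → R ≤ n → MonotoneUpTo (cumCount R) R
  cumCount-mono R p q v v<R = step (suc (suc v) ≤? R)
    where
    step : Dec (suc (suc v) ≤ R) → cumCount R v ≤ cumCount R (suc v)
    step (yes ssv≤R) = subst₂ _≤_ (sym (cumCount-below R v v<R)) (sym (cumCount-below R (suc v) ssv≤R))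
      (+-cancelˡ-≤ (at μ R) _ _ (drop‿+≤+ (subst₂ ℤ._≤_ (fillOf-form v R v<R q) (fillOf-form (suc v) R ssv≤R q) (fill-grows v R ssv≤R q))))
    step (no ssv≰R) with ≤-antisym v<R (≤-pred (≰⇒> ssv≰R))
    ... | refl = subst₂ _≤_ (sym (cumCount-below R v v<R)) (sym (cumCount-above R (suc v) ≤-refl))
      (+-cancelˡ-≤ (at μ R) _ _ (subst (at μ R ℕ.+ targetCount v R ≤_) (sym (m+[n∸m]≡n (pointwise-at μ lam μ≤λ R p q)))
                                       (drop‿+≤+ (subst (ℤ._≤ + at lam R) (fillOf-form v R ≤-refl q) (fill-below-λ R p q)))))

  builtRow : ℕ → List ℕ
  builtRow R = rowOfCounts (cumCount R) R

  L : Tableau n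
  L = Vec.tabulate (λ i → builtRow (suc (toℕ i)))

  row-of-L : ∀ R → 1 ≤ R → R ≤ n → rowAt L R ≡ builtRow R
  row-of-L R p q with toFin R p q
  ... | i , refl = trans (rowAt-lookup L i) (lookup∘tabulate _ i)

  countLe-row : ∀ R → 1 ≤ R → R ≤ n → ∀ w → countLe w (rowAt L R) ≡ cumCount R (w ⊓ R)
  countLe-row R p q w = trans (cong (countLe w) (row-of-L R p q)) (rowOfCounts-countLe (cumCount R) R (cumCount-0 R p q) (cumCount-mono R p q) w)

  countLe-below : ∀ m R → m < R → R ≤ n → countLe m (rowAt L R) ≡ targetCount m R
  countLe-below m R lt q = trans (countLe-row R (≤-trans (s≤s z≤n) lt) q m) (trans (cong (cumCount R) (m≤n⇒m⊓n≡m (<⇒≤ lt))) (cumCount-below R m lt))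

  countLe-above : ∀ m R → 1 ≤ R → R ≤ m → R ≤ n → countLe m (rowAt L R) ≡ at lam R ∸ at μ R
  countLe-above m R p le q = trans (countLe-row R p q m) (trans (cong (cumCount R) (m≥n⇒m⊓n≡n le)) (cumCount-above R R ≤-refl))

  row-length-L : ∀ R → 1 ≤ R → R ≤ n → length (rowAt L R) ≡ at lam R ∸ at μ R
  row-length-L R p q = trans (cong length (row-of-L R p q))
    (trans (rowOfCounts-length (cumCount R) R (cumCount-0 R p q) (cumCount-mono R p q)) (cumCount-above R R ≤-refl))

  row-end-L : ∀ R → 1 ≤ R → R ≤ n → at μ R ℕ.+ length (rowAt L R) ≡ at lam R
  row-end-L R p q = trans (cong (at μ R ℕ.+_) (row-length-L R p q)) (m+[n∸m]≡n (pointwise-at μ lam μ≤λ R p q))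

  row-sorted-L : ∀ R → 1 ≤ R → R ≤ n → Sorted (rowAt L R)
  row-sorted-L R p q = subst Sorted (sym (row-of-L R p q)) (rowOfCounts-sorted (cumCount R) R)

  row-range-L : ∀ R → 1 ≤ R → R ≤ n → All (λ x → 1 ≤ x × x ≤ R) (rowAt L R)
  row-range-L R p q = subst (All _) (sym (row-of-L R p q)) (rowOfCounts-range (cumCount R) R)

  fill-L : ∀ m R → m < R → R ≤ n → fill μ L m R ≡ fillOf m R
  fill-L m R lt q = trans (cong (λ z → + (at μ R ℕ.+ z)) (countLe-below m R lt q)) (sym (fillOf-form m R lt q))

  φL≈T : φ μ L ≈[ n ] T
  φL≈T = ≈-from-agree (φ-represents-fill μ L) T-represents fill-L

  T≈φL : T ≈[ n ] φ μ L
  T≈φL i j p q r = sym (φL≈T i j p q r)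

  open GZDictionary lam μ L

  row-filled-L : ∀ m → suc m ≤ n → RowFilled m
  row-filled-L m sm≤n = row-filled m (λ R p q → All.map proj₂ (row-range-L R p (≤-trans q sm≤n))) (row-end-L (suc m) (s≤s z≤n) sm≤n)

  -- The weight of T = φ(L) is the content of L.
  content-L : ∀ v → 1 ≤ v → v ≤ n → countRows L v n ≡ at ν v
  content-L (suc m) _ sm≤n = +-injective (cancel (+ at lam (suc m)) (begin
    - + at lam (suc m) ℤ.+ + countRows L (suc m) n ≡⟨ sym (weight-of-φ i m e (row-filled-L m sm≤n)) ⟩
    weightAt (φ μ L) (suc i)                         ≡⟨ weightAt-cong φL≈T (suc i) si≤n ⟩
    weightAt T (suc i)                               ≡⟨ weight (suc i) (s≤s z≤n) si≤n ⟩
    atℤ (dual lam -ᵥ dual ν) (suc i)                 ≡⟨ weight-target i m e ⟩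
    - + at lam (suc m) ℤ.+ + at ν (suc m)            ∎))
    where
    open ≡-Reasoning
    i = n ∸ suc m
    e : suc i ℕ.+ m ≡ n
    e = complement-suc sm≤n
    si≤n : suc i ≤ n
    si≤n = summand≤ (trans (+-comm m (suc i)) e)
    cancel : ∀ a {x y} → - a ℤ.+ x ≡ - a ℤ.+ y → x ≡ y
    cancel a {x} {y} eq = trans (sym (undo a x)) (trans (cong (λ z → a ℤ.+ z) eq) (undo a y))
      where
      undo : ∀ a x → a ℤ.+ (- a ℤ.+ x) ≡ x
      undo = solve-∀

  -- The exponents of T = φ(L) bound the letters a+1 in rows ≤ r by the letters a above row r.
  yamanouchi-at-row-L : ∀ r a → 1 ≤ r → r ≤ n → 1 ≤ a → countRows L (suc a) r ≤ countRows L a (r ∸ 1)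
  yamanouchi-at-row-L r a p q pa with r ≤? a
  ... | yes r≤a = ≤-trans (≤-reflexive (countRows-absent L (suc a) r
        (λ R x y → All.map (λ le → s≤s (≤-trans (proj₂ le) (≤-trans y r≤a))) (row-range-L R x (≤-trans y q))))) z≤n
  yamanouchi-at-row-L (suc r) (suc m) p q pa | no r≰a =
    +-cancelˡ-≤ c _ _ (subst₂ _≤_ (+-comm (countRows L (suc (suc m)) (suc r)) c) (countRows-suc L (suc m) r) counted)
    where
    ssm≤r : suc (suc m) ≤ suc r
    ssm≤r = ≰⇒> r≰a
    ssm≤n : suc (suc m) ≤ n
    ssm≤n = ≤-trans ssm≤r q
    i = n ∸ suc (suc m)
    e : suc i ℕ.+ suc m ≡ n
    e = complement-suc ssm≤n
    j = n ∸ suc r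
    j≤i : j ≤ i
    j≤i = ∸-monoʳ-≤ n ssm≤r
    n∸j : n ∸ j ≡ suc r
    n∸j = m∸[m∸n]≡n q
    i<n : suc i < n
    i<n = summand≤ (trans (+-comm m (suc (suc i))) (trans (sym (+-suc (suc i) m)) e))
    c = count (suc m) (rowAt L (suc r))
    exponent-L : ε (φ μ L) (suc i) (suc j) ℤ.≤ + countRows L (suc m) n - + countRows L (suc (suc m)) n
    exponent-L = subst₂ ℤ._≤_ (ε-cong T≈φL (suc i) (suc j) (s≤s z≤n) (s≤s j≤i) i<n)
      (trans (exponent-target i m e)
             (sym (cong₂ (λ a b → + a - + b) (content-L (suc m) (s≤s z≤n) (≤-trans (n≤1+n _) ssm≤n))
                                             (content-L (suc (suc m)) (s≤s z≤n) ssm≤n))))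
      (exponent (suc i) (suc j) (s≤s z≤n) (s≤s j≤i) i<n)
    counted : countRows L (suc (suc m)) (suc r) ℕ.+ c ≤ countRows L (suc m) (suc r)
    counted = exponent-bound⇒count-inequality _ _ _ _ _
      (subst (ℤ._≤ _) (trans (exponent-of-φ i j m e j≤i)
                             (cong (λ r' → (+ countRows L (suc m) n - + countRows L (suc m) r' ℤ.+ + count (suc m) (rowAt L r'))
                                            - (+ countRows L (suc (suc m)) n - + countRows L (suc (suc m)) r')) n∸j))
             exponent-L)

  yamanouchi-L : ∀ s a → 1 ≤ a → count (suc a) (drop s (readingWord L)) ≤ count a (drop s (readingWord L))
  yamanouchi-L s a pa = subst (λ w → count (suc a) (drop s w) ≤ count a (drop s w)) (sym (readingWord≡rowsUp L)) (suffix (suffix-of-rowsUp L n s))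
    where
    suffix : drop s (rowsUp L n) ≡ [] ⊎ SuffixFromRow L n (drop s (rowsUp L n)) → count (suc a) (drop s (rowsUp L n)) ≤ count a (drop s (rowsUp L n))
    suffix (inj₁ e) = subst (λ w → count (suc a) w ≤ count a w) (sym e) z≤n
    suffix (inj₂ (suc r , t , p , q , e)) = subst (λ w → count (suc a) w ≤ count a w) (sym e)
      (subst₂ _≤_ (sym (count-++ (suc a) (drop t row) above)) (sym (count-++ a (drop t row) above))
        (≤-trans (+-monoˡ-≤ (countRows L (suc a) r) (count-drop-≤ (suc a) t row))
        (≤-trans (≤-reflexive (sym (countRows-suc L (suc a) r)))
        (≤-trans (yamanouchi-at-row-L (suc r) a p q pa) (m≤n+m (countRows L a r) _)))))
      where
      row = rowAt L (suc r)
      above = rowsUp L r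

  -- With G R w = μ_R + #(entries ≤ w in row R), a box in
  -- column c of row Q holding y satisfies c ≤ G Q y, one in row P < Q holding
  -- x ≥ y satisfies G P (y−1) < c, while G Q w ≤ G P (w − 1) along diagonals.
  G : ℕ → ℕ → ℕ
  G R w = at μ R ℕ.+ countLe w (rowAt L R)

  G-step : ∀ R w → 1 ≤ R → suc R ≤ n → G (suc R) w ≤ G R (w ∸ 1)
  G-step R zero p q =
    ≤-trans (≤-reflexive (trans (cong (at μ (suc R) ℕ.+_) (trans (countLe-below 0 (suc R) (s≤s z≤n) q) (targetCount-0 (suc R) (s≤s z≤n) q)))
                                (+-identityʳ _)))
            (≤-trans (dm R p q) (m≤m+n _ _))
  G-step R (suc m) p q with suc m ≤? R
  ... | yes lt = subst₂ _≤_ (cong (at μ (suc R) ℕ.+_) (sym (countLe-below (suc m) (suc R) (s≤s lt) q)))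
                             (cong (at μ R ℕ.+_) (sym (countLe-below m R lt R≤n)))
                             (drop‿+≤+ (subst₂ ℤ._≤_ (fillOf-form (suc m) (suc R) (s≤s lt) q) (fillOf-form m R lt R≤n) (fill-shrinks m R lt q)))
    where
    R≤n : R ≤ n
    R≤n = ≤-trans (n≤1+n R) q
  ... | no ge = subst₂ _≤_ (sym (trans (cong (at μ (suc R) ℕ.+_) (countLe-above (suc m) (suc R) (s≤s z≤n) (s≤s R≤m) q)) (m+[n∸m]≡n (pointwise-at μ lam μ≤λ (suc R) (s≤s z≤n) q))))
                          (sym (trans (cong (at μ R ℕ.+_) (countLe-above m R p R≤m R≤n)) (m+[n∸m]≡n (pointwise-at μ lam μ≤λ R p R≤n))))
                          (dl R p q)
    where
    R≤n : R ≤ n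
    R≤n = ≤-trans (n≤1+n R) q
    R≤m : R ≤ m
    R≤m = ≤-pred (≰⇒> ge)

  G-steps : ∀ d P w → 1 ≤ P → P ℕ.+ suc d ≤ n → G (P ℕ.+ suc d) w ≤ G P (w ∸ 1)
  G-steps zero P w p q = subst (λ z → G z w ≤ G P (w ∸ 1)) (sym (+-comm P 1)) (G-step P w p (subst (_≤ n) (+-comm P 1) q))
  G-steps (suc d) P w p q =
    subst (λ z → G z w ≤ G P (w ∸ 1)) (sym (+-suc P (suc d)))
      (≤-trans (G-step (P ℕ.+ suc d) w (≤-trans p (m≤m+n P _)) (subst (_≤ n) (+-suc P (suc d)) q))
      (≤-trans (G-steps d P (w ∸ 1) p (≤-trans (+-monoʳ-≤ P (n≤1+n (suc d))) q))
               (+-monoʳ-≤ (at μ P) (countLe-mono (rowAt L P) (m∸n≤m (w ∸ 1) 1)))))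

  column-strict-L : ∀ P Q → 1 ≤ P → P < Q → Q ≤ n → ∀ c x y → at μ P < c → at μ Q < c →
         nth (rowAt L P) (c ∸ suc (at μ P)) ≡ just x → nth (rowAt L Q) (c ∸ suc (at μ Q)) ≡ just y → x < y
  column-strict-L P Q p P<Q q c x y μP<c μQ<c ex ey with x <? y
  ... | yes lt = lt
  ... | no x≮y = ⊥-elim (<-irrefl refl (<-≤-trans GP<c (≤-trans c≤GQ diagonal)))
    where
    y≤x : y ≤ x
    y≤x = ≮⇒≥ x≮y
    P≤n : P ≤ n
    P≤n = ≤-trans (<⇒≤ P<Q) q
    1≤Q : 1 ≤ Q
    1≤Q = ≤-trans p (<⇒≤ P<Q)
    kQ = c ∸ suc (at μ Q)
    kP = c ∸ suc (at μ P)
    1≤y : 1 ≤ y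
    1≤y = proj₁ (nth-All (row-range-L Q 1≤Q q) ey)
    kQ< : kQ < countLe y (rowAt L Q)
    kQ< with countLe y (rowAt L Q) ≤? kQ
    ... | yes le = ⊥-elim (<-irrefl refl (sorted-nth-gt y (row-sorted-L Q 1≤Q q) kQ y le ey))
    ... | no gt = ≰⇒> gt
    c≤GQ : c ≤ G Q y
    c≤GQ = subst (_≤ G Q y) (trans (+-suc (at μ Q) kQ) (m+[n∸m]≡n μQ<c)) (+-monoʳ-≤ (at μ Q) kQ<)
    kP≥ : countLe (y ∸ 1) (rowAt L P) ≤ kP
    kP≥ with countLe (y ∸ 1) (rowAt L P) ≤? kP
    ... | yes le = le
    ... | no gt = ⊥-elim (<⇒≱ (pred< 1≤y) (≤-trans y≤x (sorted-nth-le (y ∸ 1) (row-sorted-L P p P≤n) kP x (≰⇒> gt) ex)))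
      where
      pred< : ∀ {z} → 1 ≤ z → z ∸ 1 < z
      pred< (s≤s _) = ≤-refl
    GP<c : G P (y ∸ 1) < c
    GP<c = subst (G P (y ∸ 1) <_) (m+[n∸m]≡n μP<c) (s≤s (+-monoʳ-≤ (at μ P) kP≥))
    Q≡ : P ℕ.+ suc (Q ∸ suc P) ≡ Q
    Q≡ = trans (+-suc P _) (m+[n∸m]≡n P<Q)
    diagonal : G Q y ≤ G P (y ∸ 1)
    diagonal = subst (λ z → G z y ≤ G P (y ∸ 1)) Q≡ (G-steps (Q ∸ suc P) P y p (subst (_≤ n) (sym Q≡) q))

  L-is-LR : IsLR lam μ ν L
  L-is-LR = record
    { shape = λ r → trans (cong length (sym (rowAt-lookup L r)))
        (trans (row-length-L (suc (toℕ r)) (s≤s z≤n) (toℕ<n r)) (cong₂ _∸_ (at-lookup lam r) (at-lookup μ r)))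
    ; rowWeak = λ r c c' x y lt e1 e2 →
        let (p1 , n1) = entry-inv μ L r c x e1
            (p2 , n2) = entry-inv μ L r c' y e2
        in sorted-positions (subst Sorted (rowAt-lookup L r) (row-sorted-L (suc (toℕ r)) (s≤s z≤n) (toℕ<n r)))
             _ _ x y (∸-monoˡ-< lt p1) n1 n2
    ; colStrict = λ r r' lt c x y e1 e2 →
        let (p1 , n1) = entry-inv μ L r c x e1
            (p2 , n2) = entry-inv μ L r' c y e2
        in column-strict-L (suc (toℕ r)) (suc (toℕ r')) (s≤s z≤n) (s≤s lt) (toℕ<n r') c x y
             (subst (_< c) (sym (at-lookup μ r)) p1) (subst (_< c) (sym (at-lookup μ r')) p2)
             (subst₂ (λ row m → nth row (c ∸ suc m) ≡ just x) (sym (rowAt-lookup L r)) (sym (at-lookup μ r)) n1)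
             (subst₂ (λ row m → nth row (c ∸ suc m) ≡ just y) (sym (rowAt-lookup L r')) (sym (at-lookup μ r')) n2)
    ; yamanouchi = yamanouchi-L
    ; entryRange = subst (All _) (sym (readingWord≡rowsUp L)) (entries n ≤-refl)
    ; content = λ k → trans (cong (count (suc (toℕ k))) (readingWord≡rowsUp L))
                        (trans (content-L (suc (toℕ k)) (s≤s z≤n) (toℕ<n k)) (at-lookup ν k))
    }
    where
    entries : ∀ k → k ≤ n → All (λ x → 1 ≤ x × x ≤ n) (rowsUp L k)
    entries zero _ = []
    entries (suc k) q = ++⁺ (All.map (map₂ (λ b → ≤-trans b q)) (row-range-L (suc k) (s≤s z≤n) q)) (entries k (≤-trans (n≤1+n k) q))

theorem4p4 : (n : ℕ) (lam μ ν : Vec ℕ n) →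
    Dominant lam → Dominant μ → Dominant ν →
    (∀ i → lookup μ i ≤ lookup lam i) →
    ((L : Tableau n) → IsLR lam μ ν L →
        InGZ (dual μ) (dual lam -ᵥ dual ν) (dual ν) (φ μ L))
    × ((L₁ L₂ : Tableau n) → IsLR lam μ ν L₁ → IsLR lam μ ν L₂ →
        φ μ L₁ ≈[ n ] φ μ L₂ → L₁ ≡ L₂)
    × ((T : TArray) → InGZ (dual μ) (dual lam -ᵥ dual ν) (dual ν) T →
        Σ (Tableau n) (λ L → IsLR lam μ ν L × φ μ L ≈[ n ] T))
theorem4p4 n lam μ ν dl dm _ μ≤λ =
  (λ L lr → Forward.φ-in-GZ lam μ ν dl dm μ≤λ L lr) ,
  Injectivity.injective lam μ ν dl dm μ≤λ ,
  (λ T gz → let open Backward lam μ ν dl dm μ≤λ T gz in L , L-is-LR , φL≈T)
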